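{- We have $$A^{123}(x,q)=I^{123}(x,q)+\frac{x^2}{(1-xq)^2}+1,$$ $$I^{123}(x)=\frac{1-\sqrt{1-4x}}{2x}-\frac{x^2}{(1-x)^2}-1,$$ and for $n\ge1$, $I^{123}_n=C_n-(n-1)$, where $C_n=\frac1{n+1}\binom{2n}{n}$ is the $n$-th Catalan number.
   Context: For a permutation $\pi=\pi_1\cdots\pi_n$ of $[n]$, let $i_\pi$ be the smallest index $i$ with $\{\pi_1,\dots,\pi_i\}=\{1,\dots,i\}$; $\pi$ is indecomposable if $i_\pi=n$ (the empty permutation is not indecomposable). A permutation $\pi$ avoids a pattern $\tau\in\mathfrak S_k$ if no subsequence $\pi_{j_1}\cdots\pi_{j_k}$ ($j_1<\cdots<j_k$) is order-isomorphic to $\tau$. A descent of $\pi$ is an index $i$ with $\pi_i>\pi_{i+1}$. For a pattern $\sigma$, $A^\sigma_{n,i}$ (resp. $I^\sigma_{n,i}$) is the number of $\sigma$-avoiding permutations (resp. $\sigma$-avoiding indecomposable permutations) of $[n]$ with $i$ descents; $A^\sigma(x,q)=1+\sum_{n\ge1}\sum_iA^\sigma_{n,i}x^nq^i$, $I^\sigma(x,q)=\sum_{n\ge1}\sum_iI^\sigma_{n,i}x^nq^i$, $I^\sigma(x)=I^\sigma(x,1)=\sum_{n\ge1}I^\sigma_nx^n$. -}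

module Defs where

open import Data.Bool using (Bool; true; false; _∧_; _∨_; not; if_then_else_)
open import Data.Nat using (ℕ; zero; suc; _+_; _∸_; _<ᵇ_; _≡ᵇ_; _/_)
open import Data.Nat.Combinatorics using (_C_)
open import Data.Fin using (Fin; toℕ)
open import Data.List using (List; []; _∷_; [_]; map; concatMap; length; filter; allFin; upTo)
open import Data.Bool.ListAction using (any; all)
open import Data.Nat.ListAction using (sum)
open import Data.Vec using (Vec; []; _∷_; lookup; toList)
open import Relation.Nullary.Decidable using (does)
open import Relation.Unary using (Decidable)
open import Data.Bool.Properties using (T?)
open import Data.Bool using (T)

-- A permutation of [n] is represented (0-based) by its one-line notation:
-- a vector v of length n with entries in Fin n = {0,…,n-1} that are pairwise
-- distinct.  (Relabelling 1..n as 0..n-1 preserves order-isomorphism,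
-- descents and the "prefix = initial segment" property.)

allVecs : (n k : ℕ) → List (Vec (Fin k) n)
allVecs zero    k = [ [] ]
allVecs (suc n) k = concatMap (λ x → map (x ∷_) (allVecs n k)) (allFin k)

vals : ∀ {n} → Vec (Fin n) n → List ℕ
vals v = map toℕ (toList v)

ent : ∀ {n} → Vec (Fin n) n → Fin n → ℕ
ent v p = toℕ (lookup v p)

anyPos : (n : ℕ) → (Fin n → Bool) → Bool
anyPos n f = any f (allFin n)

allPos : (n : ℕ) → (Fin n → Bool) → Bool
allPos n f = all f (allFin n)

isPerm : ∀ {n} → Vec (Fin n) n → Bool
isPerm {n} v = not (anyPos n λ i → anyPos n λ j →
  (toℕ i <ᵇ toℕ j) ∧ (ent v i ≡ᵇ ent v j))

contains123 : ∀ {n} → Vec (Fin n) n → Bool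
contains123 {n} v = anyPos n λ i → anyPos n λ j → anyPos n λ k →
  (toℕ i <ᵇ toℕ j) ∧ (toℕ j <ᵇ toℕ k) ∧
  (ent v i <ᵇ ent v j) ∧ (ent v j <ᵇ ent v k)

avoids123 : ∀ {n} → Vec (Fin n) n → Bool
avoids123 v = not (contains123 v)

desL : List ℕ → ℕ
desL []           = 0
desL (x ∷ [])     = 0
desL (x ∷ y ∷ xs) = (if y <ᵇ x then 1 else 0) + desL (y ∷ xs)

des : ∀ {n} → Vec (Fin n) n → ℕ
des v = desL (vals v)

-- {π_1,…,π_i} = {1,…,i}  (0-based: the entries at positions < i are exactly
-- the values < i), stated as both inclusions.
prefixInitial : ∀ {n} → Vec (Fin n) n → ℕ → Bool
prefixInitial {n} v i =
  allPos n (λ p → not (toℕ p <ᵇ i) ∨ (ent v p <ᵇ i)) ∧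
  allPos n (λ m → not (toℕ m <ᵇ i) ∨
     anyPos n (λ p → (toℕ p <ᵇ i) ∧ (ent v p ≡ᵇ toℕ m)))

-- i_π : the smallest i ∈ {1,…,n} with {π_1,…,π_i} = {1,…,i}
-- (search from i = start upwards, at most `fuel` steps; default n)
searchFrom : ∀ {n} → Vec (Fin n) n → (fuel start : ℕ) → ℕ
searchFrom {n} v zero       start = n
searchFrom {n} v (suc fuel) start =
  if prefixInitial v start then start else searchFrom v fuel (suc start)

iπ : ∀ {n} → Vec (Fin n) n → ℕ
iπ {n} v = searchFrom v n 1

indecomposable : ∀ {n} → Vec (Fin n) n → Bool
indecomposable {zero}  v = false
indecomposable {suc n} v = iπ v ≡ᵇ suc n

count : ∀ {n} → (Vec (Fin n) n → Bool) → ℕ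
count {n} P = length (filter (λ v → T? (P v)) (allVecs n n))

A123 : ℕ → ℕ → ℕ
A123 n i = count {n} λ v → isPerm v ∧ avoids123 v ∧ (des v ≡ᵇ i)

I123 : ℕ → ℕ → ℕ
I123 n i = count {n} λ v → isPerm v ∧ avoids123 v ∧ indecomposable v ∧ (des v ≡ᵇ i)

-- I^{123}_n = Σ_i I^{123}_{n,i}  (coefficient of x^n in I^{123}(x,1));
-- a permutation of [n] has at most n descents, so summing i = 0..n suffices.
I123n : ℕ → ℕ
I123n n = sum (map (I123 n) (upTo (suc n)))

catalan : ℕ → ℕ
catalan n = ((n + n) C n) / suc n

-- Coefficient extraction of the explicit series appearing in the theorem.
-- [x^n q^i] x^2/(1-xq)^2 = Σ_{m≥0} (m+1) x^{m+2} q^m : equals n-1 if n ≥ 2 and i = n-2, else 0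
coeffX2over1mXQsq : ℕ → ℕ → ℕ
coeffX2over1mXQsq zero          i = 0
coeffX2over1mXQsq (suc zero)    i = 0
coeffX2over1mXQsq (suc (suc m)) i = if i ≡ᵇ m then suc m else 0

coeffOne2 : ℕ → ℕ → ℕ
coeffOne2 zero zero = 1
coeffOne2 _    _    = 0

-- [x^n] x^2/(1-x)^2 = n-1 if n ≥ 2, else 0
coeffX2over1mXsq : ℕ → ℕ
coeffX2over1mXsq zero          = 0
coeffX2over1mXsq (suc zero)    = 0
coeffX2over1mXsq (suc (suc m)) = suc m

coeffOne : ℕ → ℕ
coeffOne zero = 1
coeffOne _    = 0

coeffCatalanGF : ℕ → ℕ
coeffCatalanGF n = catalan n

{-# OPTIONS --safe #-}

-- Reading a permutation as the list of its entries turns the index-based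
-- predicates into structural recursions.  Every 123-avoiding permutation of
-- [n+1] arises exactly once by inserting the maximum n into a 123-avoiding
-- permutation σ of [n] at one of the positions 0, …, r, where r is the length
-- of the initial decreasing run of σ; inserting at 0 gives a run of length
-- r+1 and inserting at k ≥ 1 a run of length k.  The resulting generating tree
-- is counted by ballot numbers, and these give the Catalan numbers.  A
-- 123-avoiding permutation whose first a entries (0 < a < n) are {0, …, a−1}
-- must be (a−1 ⋯ 0)(n−1 ⋯ a): each entry of the first block lies below each
-- entry of the second, so both blocks are decreasing.  These n−1 decomposable ones all
-- have n−2 descents, and removing them gives the three formulas.

module Submission where

import Data.List.Relation.Binary.Permutation.Propositional.Properties as Perm
import Data.Product as Product
open import Algebra.Bundles using (CommutativeMonoid)
open import Algebra.Properties.CommutativeSemigroup using (interchange)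
open import Data.Bool using (Bool; true; false; _∧_; _∨_; not; if_then_else_)
open import Data.Bool.ListAction using (any; all; or; and)
open import Data.Bool.Properties using (T?; T-≡; T-∧; T-not-≡; ¬-not; not-¬; not-injective; ∧-assoc; ∧-identityʳ; ∨-identityʳ; ∨-zeroʳ; ∨-commutativeMonoid)
open import Data.Fin using (Fin; toℕ) renaming (zero to fzero; suc to fsuc)
open import Data.List using (List; []; _∷_; [_]; _++_; map; concatMap; cartesianProductWith; length; filter; take; drop; allFin; tabulate; upTo; applyUpTo; applyDownFrom)
open import Data.List.Membership.Propositional using (_∈_; _∉_; find)
open import Data.List.Membership.Propositional.Properties using (∈-++⁺ʳ; ∈-++⁻; ∈-applyUpTo⁺; ∈-applyUpTo⁻; ∈-applyDownFrom⁺; ∈-applyDownFrom⁻; ∈-cartesianProductWith⁺; ∈-cartesianProductWith⁻; ∈-concatMap⁻; ∈-concat⁺′; ∈-map⁺; ∈-map⁻; ∈-upTo⁺; ∈-upTo⁻; ∈-filter⁺; ∈-filter⁻)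
open import Data.List.Membership.Propositional.Properties.WithK using (unique∧set⇒bag)
open import Data.List.Properties using (++-identityʳ; ∷-injective; ∷-injectiveˡ; ∷-injectiveʳ; length-++; length-take; length-drop; length-applyUpTo; length-applyDownFrom; take++drop≡id; applyUpTo-∷ʳ; map-applyUpTo; map-upTo; map-++; map-∘; map-cong; map-cong-local; map-tabulate)
open import Data.List.Relation.Binary.BagAndSetEquality using (∼bag⇒↭)
open import Data.List.Relation.Unary.All as All using (All; []; _∷_)
open import Data.List.Relation.Unary.All.Properties using (¬Any⇒All¬; All¬⇒¬Any) renaming (map⁺ to All-map⁺; applyUpTo⁺₁ to All-applyUpTo⁺₁)
open import Data.List.Relation.Unary.AllPairs using ([]; _∷_)
open import Data.List.Relation.Unary.Any using (here; there)
open import Data.List.Relation.Unary.Unique.Propositional using (Unique)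
open import Data.List.Relation.Unary.Unique.Propositional.Properties using (++⁺; take⁺; drop⁺; filter⁺; upTo⁺; applyUpTo⁺₁; applyDownFrom⁺₁; cartesianProductWith⁺)
open import Data.Nat using (ℕ; zero; suc; _+_; _*_; _∸_; _/_; _<ᵇ_; _≡ᵇ_; _<_; _≤_; _≥_; z≤n; s≤s; s≤s⁻¹)
open import Data.Nat.Combinatorics using (_C_; nCk+nC[k+1]≡[n+1]C[k+1])
open import Data.Nat.DivMod using (m*n/n≡m)
open import Data.Nat.ListAction using (sum)
open import Data.Nat.ListAction.Properties using (sum-↭; sum-++)
open import Data.Nat.Properties using (_≟_; *-cancelˡ-≡; *-comm; *-identityˡ; *-distribʳ-+; *-distribˡ-+; *-identityʳ; *-zeroʳ; +-assoc; +-cancelʳ-≡; +-cancelˡ-<; +-cancelˡ-≡; +-comm; +-commutativeSemigroup; +-identityʳ; +-monoʳ-<; +-suc; +-∸-assoc; 1+n≰n; <-irrefl; <-≤-trans; <ᵇ-reflects-<; <ᵇ⇒<; <⇒<ᵇ; <⇒≢; <⇒≤; <⇒≱; m+[n∸m]≡n; m+n∸n≡m; m<n⇒0<n∸m; m<n⇒m<1+n; m≢1+m+n; m≤m+n; m≤n+m; m≤n⇒m≤1+n; m≤n⇒m⊓n≡m; n<1+n; suc-injective; ≡ᵇ⇒≡; ≡⇒≡ᵇ; ≤-<-trans; ≤-antisym; ≤-trans; ≤⇒≯; ≤∧≢⇒<; ≮⇒≥)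
open import Data.Nat.Tactic.RingSolver using (solve-∀)
open import Data.Product using (∃; ∃₂; _×_; _,_; proj₁; proj₂)
open import Data.Sum using (_⊎_; inj₁; inj₂)
open import Data.Vec using (Vec; lookup; toList) renaming ([] to []ᵥ; _∷_ to _∷ᵥ_)
open import Function using (id; _∘_; _⇔_; mk⇔; Equivalence)
open import Relation.Binary.PropositionalEquality using (_≡_; _≢_; _≗_; refl; sym; trans; cong; cong₂; subst; module ≡-Reasoning)
open import Relation.Nullary using (¬_; Dec; yes; no; contradiction; ofʸ; ofⁿ)
open import Data.List.Membership.DecPropositional _≟_ using (_∈?_)

open import Defs

private
  variable
    A B : Set

𝟙 : Bool → ℕ
𝟙 true  = 1
𝟙 false = 0

sumMap : (A → ℕ) → List A → ℕ
sumMap f xs = sum (map f xs)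

sumMap-cong-∈ : ∀ {f g : A → ℕ} xs → (∀ {x} → x ∈ xs → f x ≡ g x) → sumMap f xs ≡ sumMap g xs
sumMap-cong-∈ xs eq = cong sum (map-cong-local (All.tabulate eq))

sumMap-++ : ∀ (f : A → ℕ) xs ys → sumMap f (xs ++ ys) ≡ sumMap f xs + sumMap f ys
sumMap-++ f xs ys = trans (cong sum (map-++ f xs ys)) (sum-++ (map f xs) (map f ys))

sumMap-+ : ∀ (f g : A → ℕ) xs → sumMap (λ x → f x + g x) xs ≡ sumMap f xs + sumMap g xs
sumMap-+ f g []       = refl
sumMap-+ f g (x ∷ xs) = trans (cong (f x + g x +_) (sumMap-+ f g xs))
  (interchange +-commutativeSemigroup (f x) (g x) (sumMap f xs) (sumMap g xs))

sumMap-map : ∀ (f : B → ℕ) (g : A → B) xs → sumMap f (map g xs) ≡ sumMap (f ∘ g) xs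
sumMap-map f g xs = cong sum (sym (map-∘ xs))

length-filter≡sumMap-𝟙 : ∀ (p : A → Bool) xs → length (filter (T? ∘ p) xs) ≡ sumMap (𝟙 ∘ p) xs
length-filter≡sumMap-𝟙 p []       = refl
length-filter≡sumMap-𝟙 p (x ∷ xs) with p x
... | true  = cong suc (length-filter≡sumMap-𝟙 p xs)
... | false = length-filter≡sumMap-𝟙 p xs

sumMap-concatMap : ∀ (h : B → ℕ) (f : A → List B) xs → sumMap h (concatMap f xs) ≡ sumMap (sumMap h ∘ f) xs
sumMap-concatMap h f []       = refl
sumMap-concatMap h f (x ∷ xs) =
  trans (sumMap-++ h (f x) (concatMap f xs)) (cong (sumMap h (f x) +_) (sumMap-concatMap h f xs))

sumMap-const : ∀ c (xs : List A) → sumMap (λ _ → c) xs ≡ length xs * c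
sumMap-const c []       = refl
sumMap-const c (x ∷ xs) = cong (c +_) (sumMap-const c xs)

sumMap-unique-⇔ : ∀ (h : A → ℕ) {xs ys} → Unique xs → Unique ys → (∀ {z} → z ∈ xs ⇔ z ∈ ys) →
                sumMap h xs ≡ sumMap h ys
sumMap-unique-⇔ h ux uy xs≈ys = sum-↭ (Perm.map⁺ h (∼bag⇒↭ (unique∧set⇒bag ux uy xs≈ys)))

sumMap-comm : ∀ (F : A → B → ℕ) xs ys →
              sumMap (λ x → sumMap (F x) ys) xs ≡ sumMap (λ y → sumMap (λ x → F x y) xs) ys
sumMap-comm F []       ys = sym (trans (sumMap-const 0 ys) (*-zeroʳ (length ys)))
sumMap-comm F (x ∷ xs) ys = trans (cong (sumMap (F x) ys +_) (sumMap-comm F xs ys))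
                                  (sym (sumMap-+ (F x) (λ y → sumMap (λ x′ → F x′ y) xs) ys))

𝟙-split : ∀ p q → 𝟙 q ≡ 𝟙 (p ∧ q) + 𝟙 (not p ∧ q)
𝟙-split true  q = sym (+-identityʳ (𝟙 q))
𝟙-split false q = refl

sumMap-𝟙-∧ : ∀ (p q : A → Bool) xs → sumMap (λ x → 𝟙 (p x ∧ q x)) xs ≡ sumMap (𝟙 ∘ q) (filter (T? ∘ p) xs)
sumMap-𝟙-∧ p q []       = refl
sumMap-𝟙-∧ p q (x ∷ xs) with p x
... | true  = cong (𝟙 (q x) +_) (sumMap-𝟙-∧ p q xs)
... | false = sumMap-𝟙-∧ p q xs

sum-applyUpTo-suc : ∀ (f : ℕ → ℕ) n → sum (applyUpTo f (suc n)) ≡ sum (applyUpTo f n) + f n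
sum-applyUpTo-suc f n = begin
  sum (applyUpTo f (suc n))             ≡⟨ cong sum (applyUpTo-∷ʳ f n) ⟨
  sum (applyUpTo f n ++ [ f n ])        ≡⟨ sum-++ (applyUpTo f n) [ f n ] ⟩
  sum (applyUpTo f n) + (f n + 0)       ≡⟨ cong (sum (applyUpTo f n) +_) (+-identityʳ (f n)) ⟩
  sum (applyUpTo f n) + f n             ∎
  where open ≡-Reasoning

sumMap-𝟙-∧-≡ᵇ : ∀ b {d} N → d < N → sumMap (λ i → 𝟙 (b ∧ (d ≡ᵇ i))) (upTo N) ≡ 𝟙 b
sumMap-𝟙-∧-≡ᵇ false N _   = trans (sumMap-const 0 (upTo N)) (*-zeroʳ (length (upTo N)))
sumMap-𝟙-∧-≡ᵇ true  N d<N = trans (cong sum (map-upTo _ N)) (once N d<N)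
  where
  zeros : ∀ N → sum (applyUpTo (λ _ → 0) N) ≡ 0
  zeros zero    = refl
  zeros (suc N) = zeros N
  once : ∀ {d} N → d < N → sum (applyUpTo (λ i → 𝟙 (d ≡ᵇ i)) N) ≡ 1
  once {zero}  (suc N) _         = cong suc (zeros N)
  once {suc d} (suc N) (s≤s d<N) = once N d<N

≡ᵇ-refl : ∀ n → (n ≡ᵇ n) ≡ true
≡ᵇ-refl n = Equivalence.to T-≡ (≡⇒≡ᵇ n n refl)

≡ᵇ-false : ∀ {m n} → m ≢ n → (m ≡ᵇ n) ≡ false
≡ᵇ-false {m} {n} m≢n with m ≡ᵇ n in eq
... | true  = contradiction (≡ᵇ⇒≡ m n (Equivalence.from T-≡ eq)) m≢n
... | false = refl

≡ᵇ-false⁻ : ∀ {m n} → (m ≡ᵇ n) ≡ false → m ≢ n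
≡ᵇ-false⁻ {m} eq refl with () ← trans (sym (≡ᵇ-refl m)) eq

<ᵇ-true : ∀ {m n} → m < n → (m <ᵇ n) ≡ true
<ᵇ-true m<n = Equivalence.to T-≡ (<⇒<ᵇ m<n)

<ᵇ-true⁻ : ∀ {m n} → (m <ᵇ n) ≡ true → m < n
<ᵇ-true⁻ {m} {n} eq = <ᵇ⇒< m n (Equivalence.from T-≡ eq)

<ᵇ-false : ∀ {m n} → n ≤ m → (m <ᵇ n) ≡ false
<ᵇ-false {m} {n} n≤m with m <ᵇ n | <ᵇ-reflects-< m n
... | true  | ofʸ m<n = contradiction m<n (≤⇒≯ n≤m)
... | false | _       = refl

<ᵇ-false⁻ : ∀ {m n} → (m <ᵇ n) ≡ false → n ≤ m
<ᵇ-false⁻ {m} {n} eq with m <ᵇ n | <ᵇ-reflects-< m n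
<ᵇ-false⁻ {m} {n} () | true  | _
<ᵇ-false⁻ {m} {n} _  | false | ofⁿ m≮n = ≮⇒≥ m≮n

∨-false⁻ : ∀ {a b} → a ∨ b ≡ false → a ≡ false × b ≡ false
∨-false⁻ {false} {false} _ = refl , refl

∨-true⁻ : ∀ {a b} → a ∨ b ≡ true → a ≡ true ⊎ b ≡ true
∨-true⁻ {true}  _  = inj₁ refl
∨-true⁻ {false} eq = inj₂ eq

∨-trueˡ : ∀ {a} b → a ≡ true → a ∨ b ≡ true
∨-trueˡ b refl = refl

∨-trueʳ : ∀ a {b} → b ≡ true → a ∨ b ≡ true
∨-trueʳ a refl = ∨-zeroʳ a

∧-true⁻ : ∀ {a b} → a ∧ b ≡ true → a ≡ true × b ≡ true
∧-true⁻ {true} {true} _ = refl , refl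

∨-interchange : ∀ a b c d → (a ∨ b) ∨ (c ∨ d) ≡ (a ∨ c) ∨ (b ∨ d)
∨-interchange = interchange (CommutativeMonoid.commutativeSemigroup ∨-commutativeMonoid)

module _ (f : A → Bool) where

  any-true⁺ : ∀ {y xs} → y ∈ xs → f y ≡ true → any f xs ≡ true
  any-true⁺ {xs = x ∷ xs} (here refl) fy = cong (_∨ any f xs) fy
  any-true⁺ {xs = x ∷ xs} (there y∈)  fy = trans (cong (f x ∨_) (any-true⁺ y∈ fy)) (∨-zeroʳ (f x))

  any-true⁻ : ∀ xs → any f xs ≡ true → ∃ λ y → y ∈ xs × f y ≡ true
  any-true⁻ (x ∷ xs) eq with ∨-true⁻ {f x} eq
  ... | inj₁ fx   = x , here refl , fx
  ... | inj₂ rest = Product.map₂ (Product.map₁ there) (any-true⁻ xs rest)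

  any-false⁺ : ∀ xs → (∀ {y} → y ∈ xs → f y ≡ false) → any f xs ≡ false
  any-false⁺ []       _    = refl
  any-false⁺ (x ∷ xs) none = cong₂ _∨_ (none (here refl)) (any-false⁺ xs (none ∘ there))

  any-false⁻ : ∀ {y xs} → any f xs ≡ false → y ∈ xs → f y ≡ false
  any-false⁻ {xs = x ∷ xs} eq (here refl) = proj₁ (∨-false⁻ {f x} eq)
  any-false⁻ {xs = x ∷ xs} eq (there y∈)  = any-false⁻ (proj₂ (∨-false⁻ {f x} eq)) y∈

module _ (f : ℕ → Bool) where

  all-true⁺ : ∀ xs → (∀ {y} → y ∈ xs → f y ≡ true) → all f xs ≡ true
  all-true⁺ []       _      = refl
  all-true⁺ (x ∷ xs) all-xs = cong₂ _∧_ (all-xs (here refl)) (all-true⁺ xs (all-xs ∘ there))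

  all-true⁻ : ∀ {y xs} → all f xs ≡ true → y ∈ xs → f y ≡ true
  all-true⁻ {xs = x ∷ xs} eq (here refl) = proj₁ (∧-true⁻ {f x} eq)
  all-true⁻ {xs = x ∷ xs} eq (there y∈)  = all-true⁻ (proj₂ (∧-true⁻ {f x} eq)) y∈

and-applyUpTo-true⁺ : ∀ (f : ℕ → Bool) n → (∀ {m} → m < n → f m ≡ true) → and (applyUpTo f n) ≡ true
and-applyUpTo-true⁺ f zero    _     = refl
and-applyUpTo-true⁺ f (suc n) below = cong₂ _∧_ (below (s≤s z≤n)) (and-applyUpTo-true⁺ (f ∘ suc) n (below ∘ s≤s))

and-applyUpTo-true⁻ : ∀ (f : ℕ → Bool) n → and (applyUpTo f n) ≡ true → ∀ {m} → m < n → f m ≡ true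
and-applyUpTo-true⁻ f (suc n) eq {zero}  _         = proj₁ (∧-true⁻ {f 0} eq)
and-applyUpTo-true⁻ f (suc n) eq {suc m} (s≤s m<n) = and-applyUpTo-true⁻ (f ∘ suc) n (proj₂ (∧-true⁻ {f 0} eq)) m<n

applyUpTo-cong : ∀ {f g : ℕ → A} → f ≗ g → ∀ n → applyUpTo f n ≡ applyUpTo g n
applyUpTo-cong eq zero    = refl
applyUpTo-cong eq (suc n) = cong₂ _∷_ (eq 0) (applyUpTo-cong (eq ∘ suc) n)

take-length-++ : ∀ (xs ys : List ℕ) → take (length xs) (xs ++ ys) ≡ xs
take-length-++ []       ys = refl
take-length-++ (x ∷ xs) ys = cong (x ∷_) (take-length-++ xs ys)

0<length⇒∈ : ∀ {xs : List ℕ} → 0 < length xs → ∃ (_∈ xs)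
0<length⇒∈ {x ∷ xs} _ = x , here refl

Unique-++-disjoint : ∀ (xs ys : List ℕ) {z} → Unique (xs ++ ys) → z ∈ xs → z ∉ ys
Unique-++-disjoint (x ∷ xs) ys (x≢ ∷ _) (here refl) z∈ys = All.lookup x≢ (∈-++⁺ʳ xs z∈ys) refl
Unique-++-disjoint (x ∷ xs) ys (_ ∷ u)  (there z∈)  z∈ys = Unique-++-disjoint xs ys u z∈ z∈ys

Unique-map-∈ : ∀ {f : A → B} {xs} → Unique xs → (∀ {x y} → x ∈ xs → y ∈ xs → f x ≡ f y → x ≡ y) →
               Unique (map f xs)
Unique-map-∈ []       _   = []
Unique-map-∈ (x≢ ∷ u) inj =
  All-map⁺ (All.tabulate λ y∈ fx≡fy → All.lookup x≢ y∈ (inj (here refl) (there y∈) fx≡fy))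
  ∷ Unique-map-∈ u (λ p q → inj (there p) (there q))

Unique-concatMap : ∀ {f : A → List B} {xs} → Unique xs → (∀ {x} → x ∈ xs → Unique (f x)) →
                   (∀ {x y z} → x ∈ xs → y ∈ xs → z ∈ f x → z ∈ f y → x ≡ y) → Unique (concatMap f xs)
Unique-concatMap []       _   _    = []
Unique-concatMap {f = f} {x ∷ xs} (x≢ ∷ u) ufx same =
  ++⁺ (ufx (here refl)) (Unique-concatMap u (ufx ∘ there) λ p q → same (there p) (there q)) disjoint
  where
  disjoint : ∀ {z} → ¬ (z ∈ f x × z ∈ concatMap f xs)
  disjoint (z∈fx , z∈rest) with find (∈-concatMap⁻ f z∈rest)
  ... | y , y∈ , z∈fy = All.lookup x≢ y∈ (same (here refl) (there y∈) z∈fx z∈fy)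

All-<-pred : ∀ {m xs} → m ∉ xs → All (_< suc m) xs → All (_< m) xs
All-<-pred {m} m∉xs xs<1+m = All.tabulate λ {y} y∈ → ≤∧≢⇒< (s≤s⁻¹ (All.lookup xs<1+m y∈)) λ { refl → m∉xs y∈ }

words : ℕ → ℕ → List (List ℕ)
words zero    k = [ [] ]
words (suc n) k = cartesianProductWith _∷_ (upTo k) (words n k)

∈-words⁺ : ∀ {n k xs} → length xs ≡ n → All (_< k) xs → xs ∈ words n k
∈-words⁺ {xs = []}     refl []         = here refl
∈-words⁺ {xs = x ∷ xs} refl (x<k ∷ xs<k) = ∈-cartesianProductWith⁺ _∷_ (∈-upTo⁺ x<k) (∈-words⁺ refl xs<k)

∈-words⁻ : ∀ n k {xs} → xs ∈ words n k → length xs ≡ n × All (_< k) xs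
∈-words⁻ zero    k (here refl) = refl , []
∈-words⁻ (suc n) k xs∈ with ∈-cartesianProductWith⁻ _∷_ (upTo k) (words n k) xs∈
... | x , ys , x∈ , ys∈ , refl with ∈-words⁻ n k ys∈
...   | refl , ys<k = refl , ∈-upTo⁻ x∈ ∷ ys<k

words-unique : ∀ n k → Unique (words n k)
words-unique zero    k = [] ∷ []
words-unique (suc n) k = cartesianProductWith⁺ _∷_ ∷-injective (upTo⁺ k) (words-unique n k)

toNats : ∀ {k m} → Vec (Fin k) m → List ℕ
toNats v = map toℕ (toList v)

map-toℕ-allFin : ∀ k → map toℕ (allFin k) ≡ upTo k
map-toℕ-allFin k = shifted id id (λ _ → refl)
  where
  shifted : ∀ {m} (h : Fin m → Fin k) (g : ℕ → ℕ) → (∀ i → toℕ (h i) ≡ g (toℕ i)) →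
            map toℕ (tabulate h) ≡ applyUpTo g m
  shifted {zero}  h g eq = refl
  shifted {suc m} h g eq = cong₂ _∷_ (eq fzero) (shifted (h ∘ fsuc) (g ∘ suc) (eq ∘ fsuc))

map-toNats-allVecs : ∀ n k → map toNats (allVecs n k) ≡ words n k
map-toNats-allVecs zero    k = refl
map-toNats-allVecs (suc n) k = trans (prepend (allFin k))
  (cong₂ (cartesianProductWith _∷_) (map-toℕ-allFin k) (map-toNats-allVecs n k))
  where
  prepend : ∀ xs → map toNats (concatMap (λ x → map (x ∷ᵥ_) (allVecs n k)) xs)
                   ≡ cartesianProductWith _∷_ (map toℕ xs) (map toNats (allVecs n k))
  prepend []       = refl
  prepend (x ∷ xs) = trans (map-++ toNats (map (x ∷ᵥ_) (allVecs n k)) _) (cong₂ _++_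
    (trans (sym (map-∘ {g = toNats} (allVecs n k))) (map-∘ {g = toℕ x ∷_} (allVecs n k)))
    (prepend xs))

count≡sumMap-words : ∀ n (P : Vec (Fin n) n → Bool) (G : List ℕ → Bool) → (∀ v → P v ≡ G (vals v)) →
                     count P ≡ sumMap (𝟙 ∘ G) (words n n)
count≡sumMap-words n P G P≡G = begin
  count P                                   ≡⟨ length-filter≡sumMap-𝟙 P (allVecs n n) ⟩
  sumMap (𝟙 ∘ P) (allVecs n n)              ≡⟨ sumMap-cong-∈ (allVecs n n) (λ {v} _ → cong 𝟙 (P≡G v)) ⟩
  sumMap (𝟙 ∘ G ∘ toNats) (allVecs n n)     ≡⟨ sumMap-map (𝟙 ∘ G) toNats (allVecs n n) ⟨
  sumMap (𝟙 ∘ G) (map toNats (allVecs n n)) ≡⟨ cong (sumMap (𝟙 ∘ G)) (map-toNats-allVecs n n) ⟩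
  sumMap (𝟙 ∘ G) (words n n)                ∎
  where open ≡-Reasoning

hasDuplicate : List ℕ → Bool
hasDuplicate []       = false
hasDuplicate (x ∷ xs) = any (x ≡ᵇ_) xs ∨ hasDuplicate xs

has12 : List ℕ → Bool
has12 []       = false
has12 (x ∷ xs) = any (x <ᵇ_) xs ∨ has12 xs

has12Above : ℕ → List ℕ → Bool
has12Above x []       = false
has12Above x (y ∷ ys) = ((x <ᵇ y) ∧ any (y <ᵇ_) ys) ∨ has12Above x ys

has123 : List ℕ → Bool
has123 []       = false
has123 (x ∷ xs) = has12Above x xs ∨ has123 xs

prefixInitialL : List ℕ → ℕ → Bool
prefixInitialL xs i = all (_<ᵇ i) (take i xs) ∧ and (applyUpTo (λ m → any (_≡ᵇ m) (take i xs)) i)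

indecomposableL : ℕ → List ℕ → Bool
indecomposableL zero    xs = false
indecomposableL (suc n) xs = not (any (prefixInitialL xs) (applyUpTo suc n))

anyPos-cong : ∀ {m} {f g : Fin m → Bool} → f ≗ g → anyPos m f ≡ anyPos m g
anyPos-cong {m} f≗g = cong or (map-cong f≗g (allFin m))

allPos-cong : ∀ {m} {f g : Fin m → Bool} → f ≗ g → allPos m f ≡ allPos m g
allPos-cong {m} f≗g = cong and (map-cong f≗g (allFin m))

anyPos-suc : ∀ {m} (f : Fin (suc m) → Bool) → anyPos (suc m) f ≡ f fzero ∨ anyPos m (f ∘ fsuc)
anyPos-suc f = cong (λ bs → f fzero ∨ or bs) (trans (map-tabulate fsuc f) (sym (map-tabulate id (f ∘ fsuc))))

allPos-suc : ∀ {m} (f : Fin (suc m) → Bool) → allPos (suc m) f ≡ f fzero ∧ allPos m (f ∘ fsuc)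
allPos-suc f = cong (λ bs → f fzero ∧ and bs) (trans (map-tabulate fsuc f) (sym (map-tabulate id (f ∘ fsuc))))

allPos-true : ∀ m → allPos m (λ _ → true) ≡ true
allPos-true zero    = refl
allPos-true (suc m) = trans (allPos-suc {m} (λ _ → true)) (allPos-true m)

anyPos-false : ∀ m → anyPos m (λ _ → false) ≡ false
anyPos-false zero    = refl
anyPos-false (suc m) = trans (anyPos-suc {m} (λ _ → false)) (anyPos-false m)

anyPos-∧ˡ : ∀ m b (f : Fin m → Bool) → anyPos m (λ i → b ∧ f i) ≡ b ∧ anyPos m f
anyPos-∧ˡ m true  f = refl
anyPos-∧ˡ m false f = anyPos-false m

anyPos-lookup : ∀ {k m} (g : ℕ → Bool) (v : Vec (Fin k) m) →
                anyPos m (λ j → g (toℕ (lookup v j))) ≡ any g (toNats v)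
anyPos-lookup g []ᵥ       = refl
anyPos-lookup g (x ∷ᵥ v) =
  trans (anyPos-suc (λ j → g (toℕ (lookup (x ∷ᵥ v) j)))) (cong (g (toℕ x) ∨_) (anyPos-lookup g v))

anyPair : (m : ℕ) → (Fin m → Fin m → Bool) → Bool
anyPair m R = anyPos m λ i → anyPos m λ j → (toℕ i <ᵇ toℕ j) ∧ R i j

anyPair-suc : ∀ {m} (R : Fin (suc m) → Fin (suc m) → Bool) →
              anyPair (suc m) R ≡ anyPos m (R fzero ∘ fsuc) ∨ anyPair m (λ i j → R (fsuc i) (fsuc j))
anyPair-suc {m} R = trans (anyPos-suc (λ i → anyPos (suc m) (below i)))
  (cong₂ _∨_ (anyPos-suc (below fzero)) (anyPos-cong {m} λ i → anyPos-suc (below (fsuc i))))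
  where
  below : Fin (suc m) → Fin (suc m) → Bool
  below i j = (toℕ i <ᵇ toℕ j) ∧ R i j

anyPair-duplicate : ∀ {k m} (v : Vec (Fin k) m) →
                    anyPair m (λ i j → toℕ (lookup v i) ≡ᵇ toℕ (lookup v j)) ≡ hasDuplicate (toNats v)
anyPair-duplicate []ᵥ       = refl
anyPair-duplicate {m = suc m} (x ∷ᵥ v) =
  trans (anyPair-suc {m} λ i j → toℕ (lookup (x ∷ᵥ v) i) ≡ᵇ toℕ (lookup (x ∷ᵥ v) j))
        (cong₂ _∨_ (anyPos-lookup (toℕ x ≡ᵇ_) v) (anyPair-duplicate v))

isPerm≡ : ∀ {n} (v : Vec (Fin n) n) → isPerm v ≡ not (hasDuplicate (vals v))
isPerm≡ v = cong not (anyPair-duplicate v)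

anyPair-12Above : ∀ {k m} x (v : Vec (Fin k) m) →
  anyPair m (λ j l → (x <ᵇ toℕ (lookup v j)) ∧ (toℕ (lookup v j) <ᵇ toℕ (lookup v l))) ≡ has12Above x (toNats v)
anyPair-12Above x []ᵥ       = refl
anyPair-12Above {m = suc m} x (y ∷ᵥ v) = trans (anyPair-suc {m} λ j l → (x <ᵇ e j) ∧ (e j <ᵇ e l)) (cong₂ _∨_
  (trans (anyPos-∧ˡ m (x <ᵇ toℕ y) _) (cong ((x <ᵇ toℕ y) ∧_) (anyPos-lookup (toℕ y <ᵇ_) v)))
  (anyPair-12Above x v))
  where
  e : Fin (suc m) → ℕ
  e i = toℕ (lookup (y ∷ᵥ v) i)

anyPos-after-suc : ∀ {m} (j : Fin m) (f : Fin (suc m) → Bool) →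
  anyPos (suc m) (λ l → (toℕ (fsuc j) <ᵇ toℕ l) ∧ f l) ≡ anyPos m (λ l → (toℕ j <ᵇ toℕ l) ∧ f (fsuc l))
anyPos-after-suc j f = anyPos-suc (λ l → (toℕ (fsuc j) <ᵇ toℕ l) ∧ f l)

anyTriple : ∀ {k m} → Vec (Fin k) m → Bool
anyTriple {m = m} v = anyPair m λ i j → anyPos m λ l →
  (toℕ j <ᵇ toℕ l) ∧ (toℕ (lookup v i) <ᵇ toℕ (lookup v j)) ∧ (toℕ (lookup v j) <ᵇ toℕ (lookup v l))

anyTriple-123 : ∀ {k m} (v : Vec (Fin k) m) → anyTriple v ≡ has123 (toNats v)
anyTriple-123 []ᵥ       = refl
anyTriple-123 {m = suc m} (x ∷ᵥ v) = trans (anyPair-suc {m} R) (cong₂ _∨_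
  (trans (anyPos-cong {m} λ j → anyPos-after-suc j (λ l → (e fzero <ᵇ e (fsuc j)) ∧ (e (fsuc j) <ᵇ e l)))
         (anyPair-12Above (toℕ x) v))
  (trans (anyPos-cong {m} λ i → anyPos-cong {m} λ j → cong ((toℕ i <ᵇ toℕ j) ∧_)
           (anyPos-after-suc j (λ l → (e (fsuc i) <ᵇ e (fsuc j)) ∧ (e (fsuc j) <ᵇ e l))))
         (anyTriple-123 v)))
  where
  e : Fin (suc m) → ℕ
  e i = toℕ (lookup (x ∷ᵥ v) i)
  R : Fin (suc m) → Fin (suc m) → Bool
  R i j = anyPos (suc m) λ l → (toℕ j <ᵇ toℕ l) ∧ (e i <ᵇ e j) ∧ (e j <ᵇ e l)

avoids123≡ : ∀ {n} (v : Vec (Fin n) n) → avoids123 v ≡ not (has123 (vals v))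
avoids123≡ {n} v = cong not (trans
  (anyPos-cong {n} λ i → anyPos-cong {n} λ j → anyPos-∧ˡ n (toℕ i <ᵇ toℕ j) _)
  (anyTriple-123 v))

allPos-take : ∀ {k m} (g : ℕ → Bool) i (v : Vec (Fin k) m) →
              allPos m (λ p → not (toℕ p <ᵇ i) ∨ g (toℕ (lookup v p))) ≡ all g (take i (toNats v))
allPos-take g zero    []ᵥ       = refl
allPos-take g (suc i) []ᵥ       = refl
allPos-take {m = m} g zero (x ∷ᵥ v) = allPos-true m
allPos-take g (suc i) (x ∷ᵥ v) =
  trans (allPos-suc (λ p → not (toℕ p <ᵇ suc i) ∨ g (toℕ (lookup (x ∷ᵥ v) p))))
        (cong (g (toℕ x) ∧_) (allPos-take g i v))

anyPos-take : ∀ {k m} (g : ℕ → Bool) i (v : Vec (Fin k) m) →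
              anyPos m (λ p → (toℕ p <ᵇ i) ∧ g (toℕ (lookup v p))) ≡ any g (take i (toNats v))
anyPos-take g zero    []ᵥ       = refl
anyPos-take g (suc i) []ᵥ       = refl
anyPos-take {m = m} g zero (x ∷ᵥ v) = anyPos-false m
anyPos-take g (suc i) (x ∷ᵥ v) =
  trans (anyPos-suc (λ p → (toℕ p <ᵇ suc i) ∧ g (toℕ (lookup (x ∷ᵥ v) p))))
        (cong (g (toℕ x) ∨_) (anyPos-take g i v))

allPos-below : ∀ n i (f : ℕ → Bool) → i ≤ n →
               allPos n (λ m → not (toℕ m <ᵇ i) ∨ f (toℕ m)) ≡ and (applyUpTo f i)
allPos-below zero    zero    f z≤n       = refl
allPos-below (suc n) zero    f z≤n       = allPos-true (suc n)
allPos-below (suc n) (suc i) f (s≤s i≤n) =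
  trans (allPos-suc {n} (λ m → not (toℕ m <ᵇ suc i) ∨ f (toℕ m)))
        (cong (f 0 ∧_) (allPos-below n i (f ∘ suc) i≤n))

prefixInitial≡ : ∀ {n} (v : Vec (Fin n) n) i → i ≤ n → prefixInitial v i ≡ prefixInitialL (vals v) i
prefixInitial≡ {n} v i i≤n = cong₂ _∧_ (allPos-take (_<ᵇ i) i v)
  (trans (allPos-cong {n} λ m → cong (not (toℕ m <ᵇ i) ∨_) (anyPos-take (_≡ᵇ toℕ m) i v))
         (allPos-below n i (λ m → any (_≡ᵇ m) (take i (vals v))) i≤n))

-- The search falls back to n, which is also its last candidate s + f, so it
-- returns n exactly when no earlier candidate is an initial prefix.
searchFrom-≡ᵇ : ∀ {n} (v : Vec (Fin n) n) f s → s + f ≡ n →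
                (searchFrom v (suc f) s ≡ᵇ n) ≡ not (any (prefixInitial v) (applyUpTo (s +_) f))
searchFrom-≡ᵇ {n} v zero s s+0≡n = found (prefixInitial v s)
  where
  found : ∀ b → ((if b then s else n) ≡ᵇ n) ≡ true
  found true  = subst (λ t → (s ≡ᵇ t) ≡ true) (trans (sym (+-identityʳ s)) s+0≡n) (≡ᵇ-refl s)
  found false = ≡ᵇ-refl n
searchFrom-≡ᵇ {n} v (suc f) s s+f≡n =
  trans (step (prefixInitial v s)) (cong (λ t → not (prefixInitial v t ∨ rest)) (sym (+-identityʳ s)))
  where
  rest = any (prefixInitial v) (applyUpTo (λ j → s + suc j) f)
  step : ∀ b → ((if b then s else searchFrom v (suc f) (suc s)) ≡ᵇ n) ≡ not (b ∨ rest)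
  step true  = ≡ᵇ-false (λ s≡n → m≢1+m+n s (trans s≡n (trans (sym s+f≡n) (+-suc s f))))
  step false = trans (searchFrom-≡ᵇ v f (suc s) (trans (sym (+-suc s f)) s+f≡n))
                     (cong (not ∘ any (prefixInitial v)) (applyUpTo-cong (λ j → sym (+-suc s j)) f))

indecomposable≡ : ∀ {n} (v : Vec (Fin n) n) → indecomposable v ≡ indecomposableL n (vals v)
indecomposable≡ {zero}  v = refl
indecomposable≡ {suc n} v = trans (searchFrom-≡ᵇ v n 1 refl)
  (cong (not ∘ or) (map-cong-local (All-applyUpTo⁺₁ suc n λ {a} a<n → prefixInitial≡ v (suc a) (s≤s (<⇒≤ a<n)))))

-- Inserting a new maximum

insertAt : ℕ → ℕ → List ℕ → List ℕ
insertAt zero    m xs       = m ∷ xs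
insertAt (suc k) m []       = [ m ]
insertAt (suc k) m (x ∷ xs) = x ∷ insertAt k m xs

length-insertAt : ∀ k m xs → k ≤ length xs → length (insertAt k m xs) ≡ suc (length xs)
length-insertAt zero    m xs       _         = refl
length-insertAt (suc k) m (x ∷ xs) (s≤s k≤) = cong suc (length-insertAt k m xs k≤)

module _ {P : ℕ → Set} where

  All-insertAt⁺ : ∀ k {m xs} → P m → All P xs → All P (insertAt k m xs)
  All-insertAt⁺ zero    pm pxs         = pm ∷ pxs
  All-insertAt⁺ (suc k) pm []          = pm ∷ []
  All-insertAt⁺ (suc k) pm (px ∷ pxs) = px ∷ All-insertAt⁺ k pm pxs

  All-insertAt⁻ : ∀ k {m} xs → All P (insertAt k m xs) → P m × All P xs
  All-insertAt⁻ zero    xs       (pm ∷ pxs) = pm , pxs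
  All-insertAt⁻ (suc k) []       (pm ∷ [])  = pm , []
  All-insertAt⁻ (suc k) (x ∷ xs) (px ∷ ps)  = Product.map₂ (px ∷_) (All-insertAt⁻ k xs ps)

any-insertAt : ∀ (f : ℕ → Bool) k m xs → any f (insertAt k m xs) ≡ f m ∨ any f xs
any-insertAt f zero    m xs       = refl
any-insertAt f (suc k) m []       = refl
any-insertAt f (suc k) m (x ∷ xs) = trans (cong (f x ∨_) (any-insertAt f k m xs)) (swap (f x) (f m) (any f xs))
  where
  swap : ∀ a b c → a ∨ (b ∨ c) ≡ b ∨ (a ∨ c)
  swap true  true  c = refl
  swap true  false c = refl
  swap false b     c = refl

Unique-insertAt⁺ : ∀ k {m xs} → m ∉ xs → Unique xs → Unique (insertAt k m xs)
Unique-insertAt⁺ zero    {xs = xs}     m∉xs u          = ¬Any⇒All¬ xs m∉xs ∷ u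
Unique-insertAt⁺ (suc k) {xs = []}     _    _          = [] ∷ []
Unique-insertAt⁺ (suc k) {xs = x ∷ xs} m∉xs (x≢ ∷ u) =
  All-insertAt⁺ k (λ x≡m → m∉xs (here (sym x≡m))) x≢ ∷ Unique-insertAt⁺ k (m∉xs ∘ there) u

Unique-insertAt⁻ : ∀ k {m} xs → Unique (insertAt k m xs) → m ∉ xs × Unique xs
Unique-insertAt⁻ zero    xs       (m≢ ∷ u) = All¬⇒¬Any m≢ , u
Unique-insertAt⁻ (suc k) []       _        = (λ ()) , []
Unique-insertAt⁻ (suc k) (x ∷ xs) (x≢ ∷ u) with All-insertAt⁻ k xs x≢ | Unique-insertAt⁻ k xs u
... | x≢m , x≢xs | m∉xs , uxs = (λ { (here m≡x) → x≢m (sym m≡x) ; (there m∈) → m∉xs m∈ }) , x≢xs ∷ uxs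

∈⇒insertAt : ∀ {m xs} → m ∈ xs → ∃₂ λ k ys → k ≤ length ys × xs ≡ insertAt k m ys
∈⇒insertAt {xs = x ∷ xs} (here refl) = 0 , xs , z≤n , refl
∈⇒insertAt {xs = x ∷ xs} (there m∈) with ∈⇒insertAt m∈
... | k , ys , k≤ , refl = suc k , x ∷ ys , s≤s k≤ , refl

insertAt-injective : ∀ {m} k l {xs ys} → m ∉ xs → m ∉ ys → k ≤ length xs → l ≤ length ys →
                     insertAt k m xs ≡ insertAt l m ys → k ≡ l × xs ≡ ys
insertAt-injective zero    zero    _    _    _         _         eq = refl , ∷-injectiveʳ eq
insertAt-injective zero    (suc l) {ys = y ∷ ys} _ m∉ys _ _ eq = contradiction (here (∷-injectiveˡ eq)) m∉ys
insertAt-injective (suc k) zero    {xs = x ∷ xs} m∉xs _ _ _ eq = contradiction (here (sym (∷-injectiveˡ eq))) m∉xs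
insertAt-injective (suc k) (suc l) {x ∷ xs} {y ∷ ys} m∉xs m∉ys (s≤s k≤) (s≤s l≤) eq
  with refl ← ∷-injectiveˡ eq = Product.map (cong suc) (cong (x ∷_))
    (insertAt-injective k l (m∉xs ∘ there) (m∉ys ∘ there) k≤ l≤ (∷-injectiveʳ eq))

pigeonhole : ∀ n {xs} → Unique xs → All (_< n) xs → length xs ≤ n
pigeonhole zero    {[]}    _ _        = z≤n
pigeonhole zero    {x ∷ xs} _ (() ∷ _)
pigeonhole (suc n) {xs} u xs<1+n with n ∈? xs
... | no  n∉xs = m≤n⇒m≤1+n (pigeonhole n u (All-<-pred n∉xs xs<1+n))
... | yes n∈xs with ∈⇒insertAt n∈xs
...   | k , ys , k≤ , refl with Unique-insertAt⁻ k ys u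
...     | n∉ys , uys = subst (_≤ suc n) (sym (length-insertAt k n ys k≤))
                         (s≤s (pigeonhole n uys (All-<-pred n∉ys (proj₂ (All-insertAt⁻ k ys xs<1+n)))))

initialRun : List ℕ → ℕ
initialRun []           = 0
initialRun (x ∷ [])     = 1
initialRun (x ∷ y ∷ xs) = if x <ᵇ y then 1 else suc (initialRun (y ∷ xs))

initialRun≤length : ∀ xs → initialRun xs ≤ length xs
initialRun≤length []           = z≤n
initialRun≤length (x ∷ [])     = s≤s z≤n
initialRun≤length (x ∷ y ∷ xs) = go (x <ᵇ y) (initialRun≤length (y ∷ xs))
  where
  go : ∀ b {r l} → r ≤ l → (if b then 1 else suc r) ≤ suc l
  go true  _   = s≤s z≤n
  go false r≤l = s≤s r≤l

has12-cons₂ : ∀ x y ys → has12 (x ∷ y ∷ ys) ≡ (x <ᵇ y) ∨ has12 (y ∷ ys)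
has12-cons₂ x y ys with x <ᵇ y in x<y | any (x <ᵇ_) ys in x<ys
... | true  | _     = refl
... | false | false = refl
... | false | true  with any-true⁻ (x <ᵇ_) ys x<ys
...   | z , z∈ , x<z = sym (∨-trueˡ (has12 ys)
  (any-true⁺ (y <ᵇ_) z∈ (<ᵇ-true (≤-<-trans (<ᵇ-false⁻ {x} {y} x<y) (<ᵇ-true⁻ {x} {z} x<z)))))

has12-take : ∀ k xs → k ≤ initialRun xs → has12 (take k xs) ≡ false
has12-take zero          xs           _ = refl
has12-take (suc zero)    (x ∷ xs)     _ = refl
has12-take (suc (suc k)) (x ∷ [])     (s≤s ())
has12-take (suc (suc k)) (x ∷ y ∷ ys) k≤ = trans (has12-cons₂ x y (take k ys)) (go (x <ᵇ y) k≤)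
  where
  go : ∀ b → suc (suc k) ≤ (if b then 1 else suc (initialRun (y ∷ ys))) →
       b ∨ has12 (take (suc k) (y ∷ ys)) ≡ false
  go true  (s≤s ())
  go false (s≤s k≤′) = has12-take (suc k) (y ∷ ys) k≤′

has12-take⁻ : ∀ k xs → k ≤ length xs → has12 (take k xs) ≡ false → k ≤ initialRun xs
has12-take⁻ zero          xs           _        _  = z≤n
has12-take⁻ (suc zero)    (x ∷ [])     _        _  = s≤s z≤n
has12-take⁻ (suc zero)    (x ∷ y ∷ xs) _        _  with x <ᵇ y
... | true  = s≤s z≤n
... | false = s≤s z≤n
has12-take⁻ (suc (suc k)) (x ∷ y ∷ ys) (s≤s k≤) no12 =
  go (x <ᵇ y) (trans (sym (has12-cons₂ x y (take k ys))) no12)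
  where
  go : ∀ b → b ∨ has12 (take (suc k) (y ∷ ys)) ≡ false →
       suc (suc k) ≤ (if b then 1 else suc (initialRun (y ∷ ys)))
  go false no12′ = s≤s (has12-take⁻ (suc k) (y ∷ ys) k≤ no12′)

initialRun-insertAt-zero : ∀ m xs → All (_< m) xs → initialRun (insertAt 0 m xs) ≡ suc (initialRun xs)
initialRun-insertAt-zero m []       _           = refl
initialRun-insertAt-zero m (y ∷ ys) (y<m ∷ _) rewrite <ᵇ-false {m} {y} (<⇒≤ y<m) = refl

initialRun-insertAt-suc : ∀ k m xs → All (_< m) xs → suc k ≤ initialRun xs →
                          initialRun (insertAt (suc k) m xs) ≡ suc k
initialRun-insertAt-suc zero    m (x ∷ xs)     (x<m ∷ _)  _  rewrite <ᵇ-true x<m = refl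
initialRun-insertAt-suc (suc k) m (x ∷ [])     _          (s≤s ())
initialRun-insertAt-suc (suc k) m (x ∷ y ∷ ys) (_ ∷ ys<m) k≤ = go (x <ᵇ y) k≤
  where
  go : ∀ b → suc (suc k) ≤ (if b then 1 else suc (initialRun (y ∷ ys))) →
       (if b then 1 else suc (initialRun (y ∷ insertAt k m ys))) ≡ suc (suc k)
  go true  (s≤s ())
  go false (s≤s k≤′) = cong suc (initialRun-insertAt-suc k m (y ∷ ys) ys<m k≤′)

has12Above-all< : ∀ {m} xs → All (_< m) xs → has12Above m xs ≡ false
has12Above-all< []       _            = refl
has12Above-all< {m} (y ∷ ys) (y<m ∷ ys<m) rewrite <ᵇ-false {m} {y} (<⇒≤ y<m) = has12Above-all< ys ys<m

any-<ᵇ-all< : ∀ {m} xs → All (_< m) xs → any (m <ᵇ_) xs ≡ false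
any-<ᵇ-all< xs xs<m = any-false⁺ _ xs λ y∈ → <ᵇ-false (<⇒≤ (All.lookup xs<m y∈))

has12Above-insertAt : ∀ x k {m} xs → x < m → All (_< m) xs → k ≤ length xs →
                      has12Above x (insertAt k m xs) ≡ has12Above x xs ∨ any (x <ᵇ_) (take k xs)
has12Above-insertAt x zero {m} xs x<m xs<m _ rewrite <ᵇ-true x<m | any-<ᵇ-all< xs xs<m = sym (∨-identityʳ _)
has12Above-insertAt x (suc k) {m} (y ∷ ys) x<m (y<m ∷ ys<m) (s≤s k≤)
  rewrite any-insertAt (y <ᵇ_) k m ys | <ᵇ-true y<m | has12Above-insertAt x k ys x<m ys<m k≤ =
  absorb (x <ᵇ y) (any (y <ᵇ_) ys) (has12Above x ys) (any (x <ᵇ_) (take k ys))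
  where
  absorb : ∀ a b c d → (a ∧ true) ∨ (c ∨ d) ≡ ((a ∧ b) ∨ c) ∨ (a ∨ d)
  absorb true  b c d = sym (∨-zeroʳ _)
  absorb false b c d = refl

has123-insertAt : ∀ k {m} xs → All (_< m) xs → k ≤ length xs →
                  has123 (insertAt k m xs) ≡ has123 xs ∨ has12 (take k xs)
has123-insertAt zero          xs       xs<m         _        rewrite has12Above-all< xs xs<m = sym (∨-identityʳ _)
has123-insertAt (suc k) {m} (x ∷ xs) (x<m ∷ xs<m) (s≤s k≤)
  rewrite has12Above-insertAt x k xs x<m xs<m k≤ | has123-insertAt k xs xs<m k≤ =
  ∨-interchange (has12Above x xs) (any (x <ᵇ_) (take k xs)) (has123 xs) (has12 (take k xs))

-- The generating tree of 123-avoiding permutations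

hasDuplicate-false⁺ : ∀ {xs} → Unique xs → hasDuplicate xs ≡ false
hasDuplicate-false⁺ []         = refl
hasDuplicate-false⁺ {x ∷ xs} (x≢ ∷ u) =
  cong₂ _∨_ (any-false⁺ (x ≡ᵇ_) xs λ y∈ → ≡ᵇ-false (All.lookup x≢ y∈)) (hasDuplicate-false⁺ u)

hasDuplicate-false⁻ : ∀ xs → hasDuplicate xs ≡ false → Unique xs
hasDuplicate-false⁻ []       _  = []
hasDuplicate-false⁻ (x ∷ xs) eq with ∨-false⁻ {any (x ≡ᵇ_) xs} eq
... | x∉xs , u = All.tabulate (≡ᵇ-false⁻ ∘ any-false⁻ (x ≡ᵇ_) x∉xs) ∷ hasDuplicate-false⁻ xs u

isAvoider : List ℕ → Bool
isAvoider xs = not (hasDuplicate xs) ∧ not (has123 xs)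

avoiders : ℕ → List (List ℕ)
avoiders n = filter (T? ∘ isAvoider) (words n n)

record Avoider (n : ℕ) (π : List ℕ) : Set where
  constructor avoider
  field
    length≡ : length π ≡ n
    bounded : All (_< n) π
    unique  : Unique π
    avoids  : has123 π ≡ false

∈-avoiders⁺ : ∀ {n π} → Avoider n π → π ∈ avoiders n
∈-avoiders⁺ (avoider len bnd u av) = ∈-filter⁺ (T? ∘ isAvoider) (∈-words⁺ len bnd)
  (Equivalence.from T-∧ (Equivalence.from T-not-≡ (hasDuplicate-false⁺ u) , Equivalence.from T-not-≡ av))

∈-avoiders⁻ : ∀ {n π} → π ∈ avoiders n → Avoider n π
∈-avoiders⁻ {n} {π} π∈ with ∈-filter⁻ (T? ∘ isAvoider) {xs = words n n} π∈
... | π∈words , isAv with ∈-words⁻ n n π∈words | Equivalence.to T-∧ isAv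
...   | len , bnd | noDup , no123 =
  avoider len bnd (hasDuplicate-false⁻ π (Equivalence.to T-not-≡ noDup)) (Equivalence.to T-not-≡ no123)

avoiders-unique : ∀ n → Unique (avoiders n)
avoiders-unique n = filter⁺ (T? ∘ isAvoider) (words-unique n n)

activeSites : List ℕ → List ℕ
activeSites σ = upTo (suc (initialRun σ))

insertAt-avoider : ∀ {n σ k} → Avoider n σ → k ≤ initialRun σ → Avoider (suc n) (insertAt k n σ)
insertAt-avoider {n} {σ} {k} (avoider len bnd u av) k≤run = avoider
  (trans (length-insertAt k n σ k≤len) (cong suc len))
  (All-insertAt⁺ k (n<1+n n) (All.map m<n⇒m<1+n bnd))
  (Unique-insertAt⁺ k (λ n∈σ → <-irrefl refl (All.lookup bnd n∈σ)) u)
  (trans (has123-insertAt k σ bnd k≤len) (cong₂ _∨_ av (has12-take k σ k≤run)))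
  where
  k≤len = ≤-trans k≤run (initialRun≤length σ)

max∈avoider : ∀ {n π} → Avoider (suc n) π → n ∈ π
max∈avoider {n} {π} (avoider len bnd u _) with n ∈? π
... | yes n∈π = n∈π
... | no  n∉π = contradiction (subst (_≤ n) len (pigeonhole n u (All-<-pred n∉π bnd))) 1+n≰n

removeMax-avoider : ∀ {n π} → Avoider (suc n) π →
                    ∃₂ λ k σ → Avoider n σ × k ≤ initialRun σ × π ≡ insertAt k n σ
removeMax-avoider {n} π-av@(avoider len bnd u av) with ∈⇒insertAt (max∈avoider π-av)
... | k , σ , k≤len , refl =
  k , σ , avoider lenσ σ<n uσ (proj₁ no123-no12) , has12-take⁻ k σ k≤len (proj₂ no123-no12) , refl
  where
  n∉σ = proj₁ (Unique-insertAt⁻ k σ u)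
  uσ  = proj₂ (Unique-insertAt⁻ k σ u)
  σ<n : All (_< n) σ
  σ<n = All-<-pred n∉σ (proj₂ (All-insertAt⁻ k σ bnd))
  lenσ : length σ ≡ n
  lenσ = suc-injective (trans (sym (length-insertAt k n σ k≤len)) len)
  no123-no12 : has123 σ ≡ false × has12 (take k σ) ≡ false
  no123-no12 = ∨-false⁻ (trans (sym (has123-insertAt k σ σ<n k≤len)) av)

children : ℕ → List (List ℕ)
children n = concatMap (λ σ → map (λ k → insertAt k n σ) (activeSites σ)) (avoiders n)

∈-children⁺ : ∀ {n σ k} → σ ∈ avoiders n → k ≤ initialRun σ → insertAt k n σ ∈ children n
∈-children⁺ {n} {σ} σ∈ k≤run = ∈-concat⁺′ (∈-map⁺ (λ k → insertAt k n σ) (∈-upTo⁺ (s≤s k≤run))) (∈-map⁺ _ σ∈)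

∈-children⁻ : ∀ {n π} → π ∈ children n →
              ∃₂ λ k σ → σ ∈ avoiders n × k ∈ activeSites σ × π ≡ insertAt k n σ
∈-children⁻ {n} π∈
  with find (∈-concatMap⁻ (λ σ → map (λ k → insertAt k n σ) (activeSites σ)) {xs = avoiders n} π∈)
... | σ , σ∈ , π∈kids with ∈-map⁻ (λ k → insertAt k n σ) π∈kids
...   | k , k∈ , refl = k , σ , σ∈ , k∈ , refl

avoiders-suc⇔children : ∀ {n π} → π ∈ avoiders (suc n) ⇔ π ∈ children n
avoiders-suc⇔children {n} = mk⇔ to from
  where
  to : ∀ {π} → π ∈ avoiders (suc n) → π ∈ children n
  to π∈ with removeMax-avoider {n} (∈-avoiders⁻ π∈)
  ... | k , σ , σ-av , k≤run , refl = ∈-children⁺ {n} (∈-avoiders⁺ σ-av) k≤run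
  from : ∀ {π} → π ∈ children n → π ∈ avoiders (suc n)
  from π∈ with ∈-children⁻ {n} π∈
  ... | k , σ , σ∈ , k∈ , refl = ∈-avoiders⁺ (insertAt-avoider (∈-avoiders⁻ {n} σ∈) (s≤s⁻¹ (∈-upTo⁻ k∈)))

children-unique : ∀ n → Unique (children n)
children-unique n = Unique-concatMap (avoiders-unique n)
  (λ σ∈ → Unique-map-∈ (upTo⁺ _) λ k∈ l∈ eq → proj₁ (activeSite-injective σ∈ σ∈ k∈ l∈ eq))
  (λ σ∈ τ∈ z∈ z∈′ → sameParent σ∈ τ∈ (∈-map⁻ _ z∈) (∈-map⁻ _ z∈′))
  where
  activeSite-injective : ∀ {σ τ k l} → σ ∈ avoiders n → τ ∈ avoiders n → k ∈ activeSites σ → l ∈ activeSites τ →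
                   insertAt k n σ ≡ insertAt l n τ → k ≡ l × σ ≡ τ
  activeSite-injective {σ} {τ} σ∈ τ∈ k∈ l∈ =
    insertAt-injective _ _ (max∉ σ∈) (max∉ τ∈) (activeSite≤length σ k∈) (activeSite≤length τ l∈)
    where
    max∉ : ∀ {ρ} → ρ ∈ avoiders n → n ∉ ρ
    max∉ ρ∈ n∈ρ = <-irrefl refl (All.lookup (Avoider.bounded (∈-avoiders⁻ ρ∈)) n∈ρ)
    activeSite≤length : ∀ ρ {k} → k ∈ activeSites ρ → k ≤ length ρ
    activeSite≤length ρ k∈ = ≤-trans (s≤s⁻¹ (∈-upTo⁻ k∈)) (initialRun≤length ρ)
  sameParent : ∀ {σ τ z} → σ ∈ avoiders n → τ ∈ avoiders n →
               ∃ (λ k → k ∈ activeSites σ × z ≡ insertAt k n σ) →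
               ∃ (λ l → l ∈ activeSites τ × z ≡ insertAt l n τ) → σ ≡ τ
  sameParent σ∈ τ∈ (k , k∈ , refl) (l , l∈ , eq) = proj₂ (activeSite-injective σ∈ τ∈ k∈ l∈ eq)

sumMap-avoiders-suc : ∀ n (h : List ℕ → ℕ) →
  sumMap h (avoiders (suc n)) ≡ sumMap (λ σ → sumMap (λ k → h (insertAt k n σ)) (activeSites σ)) (avoiders n)
sumMap-avoiders-suc n h = begin
  sumMap h (avoiders (suc n))
    ≡⟨ sumMap-unique-⇔ h (avoiders-unique (suc n)) (children-unique n) (avoiders-suc⇔children {n}) ⟩
  sumMap h (children n)
    ≡⟨ sumMap-concatMap h _ (avoiders n) ⟩
  sumMap (λ σ → sumMap h (map (λ k → insertAt k n σ) (activeSites σ))) (avoiders n)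
    ≡⟨ sumMap-cong-∈ (avoiders n) (λ {σ} _ → sumMap-map h (λ k → insertAt k n σ) (activeSites σ)) ⟩
  sumMap (λ σ → sumMap (λ k → h (insertAt k n σ)) (activeSites σ)) (avoiders n) ∎
  where open ≡-Reasoning

-- ballot m d counts the nodes m levels below a node labelled d in the tree
-- with rule (d) → (d+1)(1)(2)⋯(d); label σ by its initialRun.
ballot : ℕ → ℕ → ℕ
ballot zero    d = 1
ballot (suc m) d = sum (applyUpTo (ballot m ∘ suc) (suc d))

sumMap-ballot-activeSites : ∀ m n σ → All (_< n) σ →
  sumMap (λ k → ballot m (initialRun (insertAt k n σ))) (activeSites σ) ≡ ballot (suc m) (initialRun σ)
sumMap-ballot-activeSites m n σ σ<n = begin
  ballot m (initialRun (insertAt 0 n σ)) + sumMap (λ k → ballot m (initialRun (insertAt k n σ))) (applyUpTo suc r)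
    ≡⟨ cong₂ _+_ (cong (ballot m) (initialRun-insertAt-zero n σ σ<n)) (sumMap-cong-∈ (applyUpTo suc r) later) ⟩
  ballot m (suc r) + sum (map (ballot m) (applyUpTo suc r))
    ≡⟨ cong (λ s → ballot m (suc r) + sum s) (map-applyUpTo suc (ballot m) r) ⟩
  ballot m (suc r) + sum (applyUpTo (ballot m ∘ suc) r)
    ≡⟨ +-comm (ballot m (suc r)) _ ⟩
  sum (applyUpTo (ballot m ∘ suc) r) + ballot m (suc r)
    ≡⟨ sum-applyUpTo-suc (ballot m ∘ suc) r ⟨
  ballot (suc m) r ∎
  where
  open ≡-Reasoning
  r = initialRun σ
  later : ∀ {k} → k ∈ applyUpTo suc r → ballot m (initialRun (insertAt k n σ)) ≡ ballot m k
  later k∈ with ∈-applyUpTo⁻ suc k∈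
  ... | i , i<r , refl = cong (ballot m) (initialRun-insertAt-suc i n σ σ<n i<r)

sumMap-ballot-avoiders : ∀ n m → sumMap (ballot m ∘ initialRun) (avoiders n) ≡ ballot (n + m) 0
sumMap-ballot-avoiders zero    m = +-identityʳ (ballot m 0)
sumMap-ballot-avoiders (suc n) m = begin
  sumMap (ballot m ∘ initialRun) (avoiders (suc n))
    ≡⟨ sumMap-avoiders-suc n (ballot m ∘ initialRun) ⟩
  sumMap (λ σ → sumMap (λ k → ballot m (initialRun (insertAt k n σ))) (activeSites σ)) (avoiders n)
    ≡⟨ sumMap-cong-∈ (avoiders n) (λ σ∈ → sumMap-ballot-activeSites m n _ (Avoider.bounded (∈-avoiders⁻ σ∈))) ⟩
  sumMap (ballot (suc m) ∘ initialRun) (avoiders n)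
    ≡⟨ sumMap-ballot-avoiders n (suc m) ⟩
  ballot (n + suc m) 0
    ≡⟨ cong (λ t → ballot t 0) (+-suc n m) ⟩
  ballot (suc n + m) 0 ∎
  where open ≡-Reasoning

length-avoiders : ∀ n → length (avoiders n) ≡ ballot n 0
length-avoiders n = begin
  length (avoiders n)                   ≡⟨ *-identityʳ _ ⟨
  length (avoiders n) * 1               ≡⟨ sumMap-const 1 (avoiders n) ⟨
  sumMap (ballot 0 ∘ initialRun) (avoiders n) ≡⟨ sumMap-ballot-avoiders n 0 ⟩
  ballot (n + 0) 0                      ≡⟨ cong (λ t → ballot t 0) (+-identityʳ n) ⟩
  ballot n 0                            ∎
  where open ≡-Reasoning

-- Ballot numbers and Catalan numbers

binom : ℕ → ℕ → ℕ
binom zero    zero    = 1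
binom zero    (suc k) = 0
binom (suc n) zero    = 1
binom (suc n) (suc k) = binom n k + binom n (suc k)

binom-n-0 : ∀ n → binom n 0 ≡ 1
binom-n-0 zero    = refl
binom-n-0 (suc n) = refl

C≡binom : ∀ n k → n C k ≡ binom n k
C≡binom zero    zero    = refl
C≡binom zero    (suc k) = refl
C≡binom (suc n) zero    = refl
C≡binom (suc n) (suc k) =
  trans (sym (nCk+nC[k+1]≡[n+1]C[k+1] n k)) (cong₂ _+_ (C≡binom n k) (C≡binom n (suc k)))

binom-n-1 : ∀ n → binom n 1 ≡ n
binom-n-1 zero    = refl
binom-n-1 (suc n) = cong₂ _+_ (binom-n-0 n) (binom-n-1 n)

binom-absorb : ∀ n k → suc k * binom (suc n) (suc k) ≡ suc n * binom n k
binom-absorb n       zero    = begin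
  1 * binom (suc n) 1  ≡⟨ *-identityˡ _ ⟩
  binom (suc n) 1      ≡⟨ binom-n-1 (suc n) ⟩
  suc n                ≡⟨ *-identityʳ (suc n) ⟨
  suc n * 1            ≡⟨ cong (suc n *_) (binom-n-0 n) ⟨
  suc n * binom n 0    ∎
  where open ≡-Reasoning
binom-absorb zero    (suc k) = *-zeroʳ (suc k)
binom-absorb (suc n) (suc k) = begin
  suc (suc k) * (c + d)               ≡⟨ *-distribˡ-+ (suc (suc k)) c d ⟩
  (c + suc k * c) + suc (suc k) * d   ≡⟨ cong₂ (λ u v → (c + u) + v) (binom-absorb n k) (binom-absorb n (suc k)) ⟩
  (c + suc n * a) + suc n * b         ≡⟨ regroup n a b ⟩
  suc (suc n) * c                     ∎
  where
  open ≡-Reasoning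
  a = binom n k
  b = binom n (suc k)
  c = binom (suc n) (suc k)
  d = binom (suc n) (suc (suc k))
  regroup : ∀ n a b → (a + b) + suc n * a + suc n * b ≡ suc (suc n) * (a + b)
  regroup = solve-∀

binom-ratio : ∀ k j → suc k * binom (k + j) (suc k) ≡ j * binom (k + j) k
binom-ratio k j = +-cancelʳ-≡ (suc k * y) (suc k * x) (j * y) (begin
  suc k * x + suc k * y        ≡⟨ *-distribˡ-+ (suc k) x y ⟨
  suc k * (x + y)              ≡⟨ cong (suc k *_) (+-comm x y) ⟩
  suc k * binom (suc (k + j)) (suc k) ≡⟨ binom-absorb (k + j) k ⟩
  suc (k + j) * y              ≡⟨ cong (_* y) (+-comm (suc k) j) ⟩
  (j + suc k) * y              ≡⟨ *-distribʳ-+ y j (suc k) ⟩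
  j * y + suc k * y            ∎)
  where
  open ≡-Reasoning
  x = binom (k + j) (suc k)
  y = binom (k + j) k

binom-middle : ∀ m → binom (suc (m + m)) (suc m) ≡ binom (suc (m + m)) m
binom-middle m =
  subst (λ t → binom t (suc m) ≡ binom t m) (+-suc m m) (*-cancelˡ-≡ _ _ (suc m) (binom-ratio m (suc m)))

binom-pred : ℕ → ℕ → ℕ
binom-pred N zero    = 0
binom-pred N (suc m) = binom N m

binom-pascal-pred : ∀ N m → binom (suc N) m ≡ binom-pred N m + binom N m
binom-pascal-pred N zero    = sym (binom-n-0 N)
binom-pascal-pred N (suc m) = refl

ballot-suc-suc : ∀ m d → ballot (suc m) (suc d) ≡ ballot (suc m) d + ballot m (suc (suc d))
ballot-suc-suc m d = sum-applyUpTo-suc (ballot m ∘ suc) (suc d)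

-- ballot m d = C(2m+d, m) − C(2m+d, m−1), where binom-pred N m is C(N, m−1)
-- with C(N, −1) = 0.
ballot-binom : ∀ m d N → N ≡ m + m + d → ballot m d + binom-pred N m ≡ binom N m
ballot-binom zero    d       N _    = sym (binom-n-0 N)
ballot-binom (suc m) zero    N N≡ =
  subst (λ t → ballot (suc m) 0 + binom-pred t (suc m) ≡ binom t (suc m)) (sym (trans N≡ (regroup m))) (begin
  ballot (suc m) 0 + binom (suc K) m             ≡⟨ cong₂ _+_ (+-identityʳ (ballot m 1)) (binom-pascal-pred K m) ⟩
  ballot m 1 + (binom-pred K m + binom K m)      ≡⟨ +-assoc (ballot m 1) _ _ ⟨
  (ballot m 1 + binom-pred K m) + binom K m      ≡⟨ cong (_+ binom K m) (ballot-binom m 1 K (+-comm 1 (m + m))) ⟩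
  binom K m + binom K m                          ≡⟨ cong (binom K m +_) (binom-middle m) ⟨
  binom (suc K) (suc m)                          ∎)
  where
  open ≡-Reasoning
  K = suc (m + m)
  regroup : ∀ m → suc m + suc m + 0 ≡ suc (suc (m + m))
  regroup = solve-∀
ballot-binom (suc m) (suc d) N refl = begin
  ballot (suc m) (suc d) + binom N m
    ≡⟨ cong₂ _+_ (ballot-suc-suc m d) (binom-pascal-pred N′ m) ⟩
  (ballot (suc m) d + ballot m (suc (suc d))) + (binom-pred N′ m + binom N′ m)
    ≡⟨ regroup (ballot (suc m) d) _ _ _ ⟩
  (ballot m (suc (suc d)) + binom-pred N′ m) + (ballot (suc m) d + binom N′ m)
    ≡⟨ cong₂ _+_ (ballot-binom m (suc (suc d)) N′ (shift₁ m d)) (ballot-binom (suc m) d N′ (shift₂ m d)) ⟩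
  binom N′ m + binom N′ (suc m) ∎
  where
  open ≡-Reasoning
  N′ = m + suc m + suc d
  regroup : ∀ a b c d → (a + b) + (c + d) ≡ (b + c) + (a + d)
  regroup = solve-∀
  shift₁ : ∀ m d → m + suc m + suc d ≡ m + m + suc (suc d)
  shift₁ = solve-∀
  shift₂ : ∀ m d → m + suc m + suc d ≡ suc m + suc m + d
  shift₂ = solve-∀

ballot-catalan : ∀ n → ballot n 0 ≡ catalan n
ballot-catalan zero        = refl
ballot-catalan n@(suc m) = begin
  ballot n 0                   ≡⟨ m*n/n≡m (ballot n 0) (suc n) ⟨
  ballot n 0 * suc n / suc n   ≡⟨ cong (_/ suc n) scaled ⟩
  binom (n + n) n / suc n      ≡⟨ cong (_/ suc n) (C≡binom (n + n) n) ⟨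
  catalan n                    ∎
  where
  open ≡-Reasoning
  P = binom (n + n) n
  Q = binom (n + n) m
  central : n * P ≡ suc n * Q
  central = subst (λ t → n * binom t n ≡ suc n * binom t m) (shift m) (binom-ratio m (suc n))
    where
    shift : ∀ m → m + suc (suc m) ≡ suc m + suc m
    shift = solve-∀
  scaled : ballot n 0 * suc n ≡ P
  scaled = +-cancelʳ-≡ (suc n * Q) (ballot n 0 * suc n) P (begin
    ballot n 0 * suc n + suc n * Q  ≡⟨ cong (_+ suc n * Q) (*-comm (ballot n 0) (suc n)) ⟩
    suc n * ballot n 0 + suc n * Q  ≡⟨ *-distribˡ-+ (suc n) (ballot n 0) Q ⟨
    suc n * (ballot n 0 + Q)        ≡⟨ cong (suc n *_) (ballot-binom n 0 (n + n) (sym (+-identityʳ (n + n)))) ⟩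
    P + n * P                       ≡⟨ cong (P +_) central ⟩
    P + suc n * Q                   ∎)

-- Decomposable 123-avoiding permutations

has12Above⇒has12 : ∀ x zs → has12Above x zs ≡ true → has12 zs ≡ true
has12Above⇒has12 x (z ∷ zs) eq with ∨-true⁻ {(x <ᵇ z) ∧ any (z <ᵇ_) zs} eq
... | inj₁ first = ∨-trueˡ (has12 zs) (proj₂ (∧-true⁻ {x <ᵇ z} first))
... | inj₂ later = ∨-trueʳ (any (z <ᵇ_) zs) (has12Above⇒has12 x zs later)

has123⇒has12 : ∀ zs → has123 zs ≡ true → has12 zs ≡ true
has123⇒has12 (z ∷ zs) eq with ∨-true⁻ {has12Above z zs} eq
... | inj₁ first = ∨-trueʳ (any (z <ᵇ_) zs) (has12Above⇒has12 z zs first)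
... | inj₂ later = ∨-trueʳ (any (z <ᵇ_) zs) (has123⇒has12 zs later)

has12Above-++⁻ : ∀ x ys zs → has12Above x (ys ++ zs) ≡ true → any (x <ᵇ_) ys ≡ true ⊎ has12 zs ≡ true
has12Above-++⁻ x []       zs eq = inj₂ (has12Above⇒has12 x zs eq)
has12Above-++⁻ x (y ∷ ys) zs eq with ∨-true⁻ {(x <ᵇ y) ∧ any (y <ᵇ_) (ys ++ zs)} eq
... | inj₁ first = inj₁ (∨-trueˡ (any (x <ᵇ_) ys) (proj₁ (∧-true⁻ {x <ᵇ y} first)))
... | inj₂ later with has12Above-++⁻ x ys zs later
...   | inj₁ x<ys = inj₁ (∨-trueʳ (x <ᵇ y) x<ys)
...   | inj₂ 12zs = inj₂ 12zs

has123-++ : ∀ us vs → has12 us ≡ false → has12 vs ≡ false → has123 (us ++ vs) ≡ false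
has123-++ []       vs _      no12vs = ¬-not (not-¬ no12vs ∘ has123⇒has12 vs)
has123-++ (u ∷ us) vs no12us no12vs with ∨-false⁻ {any (u <ᵇ_) us} no12us
... | u≮us , no12us′ = cong₂ _∨_ (¬-not above) (has123-++ us vs no12us′ no12vs)
  where
  above : has12Above u (us ++ vs) ≢ true
  above eq with has12Above-++⁻ u us vs eq
  ... | inj₁ u<us = not-¬ u≮us u<us
  ... | inj₂ 12vs = not-¬ no12vs 12vs

has12Above-++-mid : ∀ {x y v} ys zs → y ∈ ys → x < y → v ∈ zs → y < v → has12Above x (ys ++ zs) ≡ true
has12Above-++-mid {x} {y} (y ∷ ys) zs (here refl) x<y v∈zs y<v
  rewrite <ᵇ-true x<y | any-true⁺ (y <ᵇ_) (∈-++⁺ʳ ys v∈zs) (<ᵇ-true y<v) = refl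
has12Above-++-mid {x} (y′ ∷ ys) zs (there y∈) x<y v∈zs y<v =
  ∨-trueʳ ((x <ᵇ y′) ∧ any (y′ <ᵇ_) (ys ++ zs)) (has12Above-++-mid ys zs y∈ x<y v∈zs y<v)

has123-++ˡ : ∀ us vs {v} → has12 us ≡ true → v ∈ vs → All (_< v) us → has123 (us ++ vs) ≡ true
has123-++ˡ (u ∷ us) vs 12us v∈vs (u<v ∷ us<v) with ∨-true⁻ {any (u <ᵇ_) us} 12us
... | inj₁ u<us with any-true⁻ (u <ᵇ_) us u<us
...   | y , y∈us , u<y = ∨-trueˡ (has123 (us ++ vs))
  (has12Above-++-mid us vs y∈us (<ᵇ-true⁻ {u} u<y) v∈vs (All.lookup us<v y∈us))
has123-++ˡ (u ∷ us) vs 12us v∈vs (u<v ∷ us<v) | inj₂ 12us′ =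
  ∨-trueʳ (has12Above u (us ++ vs)) (has123-++ˡ us vs 12us′ v∈vs us<v)

has12Above-++ʳ : ∀ {x} ys zs → has12Above x zs ≡ true → has12Above x (ys ++ zs) ≡ true
has12Above-++ʳ []       zs eq = eq
has12Above-++ʳ {x} (y ∷ ys) zs eq = ∨-trueʳ ((x <ᵇ y) ∧ any (y <ᵇ_) (ys ++ zs)) (has12Above-++ʳ ys zs eq)

has12⇒has12Above : ∀ {x} vs → has12 vs ≡ true → All (x <_) vs → has12Above x vs ≡ true
has12⇒has12Above {x} (y ∷ ys) 12vs (x<y ∷ x<ys) with ∨-true⁻ {any (y <ᵇ_) ys} 12vs
... | inj₁ y<ys rewrite <ᵇ-true x<y | y<ys = refl
... | inj₂ 12ys = ∨-trueʳ ((x <ᵇ y) ∧ any (y <ᵇ_) ys) (has12⇒has12Above ys 12ys x<ys)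

has123-++ʳ : ∀ us vs {u} → has12 vs ≡ true → u ∈ us → All (u <_) vs → has123 (us ++ vs) ≡ true
has123-++ʳ (u ∷ us) vs 12vs (here refl) u<vs =
  ∨-trueˡ (has123 (us ++ vs)) (has12Above-++ʳ us vs (has12⇒has12Above vs 12vs u<vs))
has123-++ʳ (u′ ∷ us) vs 12vs (there u∈) u<vs =
  ∨-trueʳ (has12Above u′ (us ++ vs)) (has123-++ʳ us vs 12vs u∈ u<vs)

descending : ℕ → ℕ → List ℕ
descending lo l = applyDownFrom (lo +_) l

∈-descending⁻ : ∀ {lo l y} → y ∈ descending lo l → lo ≤ y × y < lo + l
∈-descending⁻ {lo} y∈ with ∈-applyDownFrom⁻ (lo +_) y∈
... | i , i<l , refl = m≤m+n lo i , +-monoʳ-< lo i<l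

∈-descending⁺ : ∀ {lo l y} → lo ≤ y → y < lo + l → y ∈ descending lo l
∈-descending⁺ {lo} {l} {y} lo≤y y<lo+l = subst (_∈ descending lo l) (m+[n∸m]≡n lo≤y)
  (∈-applyDownFrom⁺ (lo +_) (+-cancelˡ-< lo _ _ (subst (_< lo + l) (sym (m+[n∸m]≡n lo≤y)) y<lo+l)))

descending-unique : ∀ lo l → Unique (descending lo l)
descending-unique lo l = applyDownFrom⁺₁ (lo +_) l λ j<i _ eq → <⇒≢ j<i (sym (+-cancelˡ-≡ lo _ _ eq))

descending-has12 : ∀ lo l → has12 (descending lo l) ≡ false
descending-has12 lo zero    = refl
descending-has12 lo (suc l) = cong₂ _∨_
  (any-false⁺ _ (descending lo l) λ y∈ → <ᵇ-false (<⇒≤ (proj₂ (∈-descending⁻ y∈))))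
  (descending-has12 lo l)

decreasing-tail : ∀ {x xs} → Unique (x ∷ xs) → has12 (x ∷ xs) ≡ false → All (_< x) xs
decreasing-tail {x} {xs} (x≢ ∷ _) no12 = All.tabulate λ {y} y∈ →
  ≤∧≢⇒< (<ᵇ-false⁻ (any-false⁻ (x <ᵇ_) (proj₁ (∨-false⁻ {any (x <ᵇ_) xs} no12)) y∈))
        (λ y≡x → All.lookup x≢ y∈ (sym y≡x))

decreasing-head : ∀ {lo} x xs → Unique (x ∷ xs) → has12 (x ∷ xs) ≡ false → All (lo ≤_) (x ∷ xs) →
                  lo + length xs ≤ x
decreasing-head {lo} x []       _          _    (lo≤x ∷ _)  = subst (_≤ x) (sym (+-identityʳ lo)) lo≤x
decreasing-head {lo} x (y ∷ ys) u@(_ ∷ u′) no12 (_ ∷ lo≤ys) = subst (_≤ x) (sym (+-suc lo (length ys)))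
  (<-≤-trans (s≤s (decreasing-head y ys u′ (proj₂ (∨-false⁻ {any (x <ᵇ_) (y ∷ ys)} no12)) lo≤ys))
             (All.head (decreasing-tail u no12)))

decreasing≡descending : ∀ {lo} l xs → length xs ≡ l → Unique xs → has12 xs ≡ false →
                        All (lo ≤_) xs → All (_< lo + l) xs → xs ≡ descending lo l
decreasing≡descending zero    []       _    _ _    _     _ = refl
decreasing≡descending {lo} (suc l) (x ∷ xs) refl u@(_ ∷ u′) no12 lo≤ (x< ∷ _) =
  cong₂ _∷_ x≡ (decreasing≡descending l xs refl u′ (proj₂ (∨-false⁻ {any (x <ᵇ_) xs} no12)) (All.tail lo≤)
                 (subst (λ t → All (_< t) xs) x≡ (decreasing-tail u no12)))
  where
  x≡ : x ≡ lo + length xs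
  x≡ = ≤-antisym (s≤s⁻¹ (subst (x <_) (+-suc lo (length xs)) x<)) (decreasing-head x xs u no12 lo≤)

δ⊕δ : ℕ → ℕ → List ℕ
δ⊕δ n a = descending 0 a ++ descending a (n ∸ a)

-- The empty permutation is not indecomposable.
decomposables : ℕ → List (List ℕ)
decomposables zero    = [ [] ]
decomposables (suc n) = applyUpTo (δ⊕δ (suc n) ∘ suc) n

δ⊕δ-avoider : ∀ {N a} → a ≤ N → Avoider N (δ⊕δ N a)
δ⊕δ-avoider {N} {a} a≤N = avoider
  (trans (length-++ (descending 0 a))
         (trans (cong₂ _+_ (length-applyDownFrom _ a) (length-applyDownFrom _ (N ∸ a))) a+[N∸a]≡N))
  (All.tabulate λ y∈ → bounded (∈-++⁻ (descending 0 a) y∈))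
  (++⁺ (descending-unique 0 a) (descending-unique a (N ∸ a))
       λ (y∈ˡ , y∈ʳ) → <⇒≱ (proj₂ (∈-descending⁻ y∈ˡ)) (proj₁ (∈-descending⁻ y∈ʳ)))
  (has123-++ (descending 0 a) (descending a (N ∸ a)) (descending-has12 0 a) (descending-has12 a (N ∸ a)))
  where
  a+[N∸a]≡N = m+[n∸m]≡n a≤N
  bounded : ∀ {y} → y ∈ descending 0 a ⊎ y ∈ descending a (N ∸ a) → y < N
  bounded (inj₁ y∈) = <-≤-trans (proj₂ (∈-descending⁻ y∈)) a≤N
  bounded (inj₂ y∈) = subst (_ <_) a+[N∸a]≡N (proj₂ (∈-descending⁻ y∈))

take-δ⊕δ : ∀ N a → take a (δ⊕δ N a) ≡ descending 0 a
take-δ⊕δ N a =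
  subst (λ l → take l (δ⊕δ N a) ≡ descending 0 a) (length-applyDownFrom _ a) (take-length-++ (descending 0 a) _)

prefixInitialL-δ⊕δ : ∀ N a → prefixInitialL (δ⊕δ N a) a ≡ true
prefixInitialL-δ⊕δ N a rewrite take-δ⊕δ N a = cong₂ _∧_
  (all-true⁺ (_<ᵇ a) (descending 0 a) λ y∈ → <ᵇ-true (proj₂ (∈-descending⁻ y∈)))
  (and-applyUpTo-true⁺ _ a λ {m} m<a → any-true⁺ (_≡ᵇ m) (∈-descending⁺ z≤n m<a) (≡ᵇ-refl m))

prefixInitialL-true⁻ : ∀ xs a → prefixInitialL xs a ≡ true →
                       All (_< a) (take a xs) × (∀ {m} → m < a → m ∈ take a xs)
prefixInitialL-true⁻ xs a pre with ∧-true⁻ {all (_<ᵇ a) (take a xs)} pre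
... | below , covers = All.tabulate (λ y∈ → <ᵇ-true⁻ (all-true⁻ (_<ᵇ a) below y∈)) , occurs
  where
  occurs : ∀ {m} → m < a → m ∈ take a xs
  occurs {m} m<a with any-true⁻ (_≡ᵇ m) (take a xs) (and-applyUpTo-true⁻ _ a covers m<a)
  ... | y , y∈ , y≡m = subst (_∈ take a xs) (≡ᵇ⇒≡ y m (Equivalence.from T-≡ y≡m)) y∈

avoider-prefixInitial⇒δ⊕δ : ∀ {N π a} → Avoider N π → 0 < a → a < N → prefixInitialL π a ≡ true → π ≡ δ⊕δ N a
avoider-prefixInitial⇒δ⊕δ {N} {π} {a} (avoider len bnd u no123) 0<a a<N pre = begin
  π        ≡⟨ take++drop≡id a π ⟨
  us ++ vs ≡⟨ cong₂ _++_ us≡ vs≡ ⟩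
  δ⊕δ N a  ∎
  where
  open ≡-Reasoning
  us = take a π
  vs = drop a π
  split = take++drop≡id a π
  a≤N = <⇒≤ a<N
  us<a = proj₁ (prefixInitialL-true⁻ π a pre)
  us⊇ = proj₂ (prefixInitialL-true⁻ π a pre)
  lenus : length us ≡ a
  lenus = trans (length-take a π) (m≤n⇒m⊓n≡m (subst (a ≤_) (sym len) a≤N))
  lenvs : length vs ≡ N ∸ a
  lenvs = trans (length-drop a π) (cong (_∸ a) len)
  a≤vs : All (a ≤_) vs
  a≤vs = All.tabulate λ y∈ → ≮⇒≥ λ y<a → Unique-++-disjoint us vs (subst Unique (sym split) u) (us⊇ y<a) y∈
  vs<N : All (_< a + (N ∸ a)) vs
  vs<N = All.tabulate λ y∈ →
    subst (_ <_) (sym (m+[n∸m]≡n a≤N)) (All.lookup bnd (subst (_ ∈_) split (∈-++⁺ʳ us y∈)))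
  no123′ : has123 (us ++ vs) ≡ false
  no123′ = trans (cong has123 split) no123
  no12us : has12 us ≡ false
  no12us with v , v∈ ← 0<length⇒∈ (subst (0 <_) (sym lenvs) (m<n⇒0<n∸m a<N)) =
    ¬-not (not-¬ no123′ ∘ λ 12us →
      has123-++ˡ us vs 12us v∈ (All.map (λ y<a → <-≤-trans y<a (All.lookup a≤vs v∈)) us<a))
  no12vs : has12 vs ≡ false
  no12vs with w , w∈ ← 0<length⇒∈ (subst (0 <_) (sym lenus) 0<a) =
    ¬-not (not-¬ no123′ ∘ λ 12vs → has123-++ʳ us vs 12vs w∈ (All.map (<-≤-trans (All.lookup us<a w∈)) a≤vs))
  us≡ : us ≡ descending 0 a
  us≡ = decreasing≡descending a us lenus (take⁺ a u) no12us (All.tabulate λ _ → z≤n) us<a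
  vs≡ : vs ≡ descending a (N ∸ a)
  vs≡ = decreasing≡descending (N ∸ a) vs lenvs (drop⁺ a u) no12vs a≤vs vs<N

decomposableAvoiders : ℕ → List (List ℕ)
decomposableAvoiders n = filter (T? ∘ not ∘ indecomposableL n) (avoiders n)

decomposableAvoiders⇔decomposables : ∀ {n π} → π ∈ decomposableAvoiders n ⇔ π ∈ decomposables n
decomposableAvoiders⇔decomposables {zero}  = mk⇔ id id
decomposableAvoiders⇔decomposables {suc n} = mk⇔ to from
  where
  to : ∀ {π} → π ∈ decomposableAvoiders (suc n) → π ∈ decomposables (suc n)
  to {π} π∈ with ∈-filter⁻ (T? ∘ not ∘ indecomposableL (suc n)) {xs = avoiders (suc n)} π∈
  ... | π∈av , dec with any-true⁻ (prefixInitialL π) (applyUpTo suc n) (not-injective (Equivalence.to T-not-≡ dec))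
  ...   | a , a∈ , pre with ∈-applyUpTo⁻ suc a∈
  ...     | j , j<n , refl =
    subst (_∈ decomposables (suc n)) (sym (avoider-prefixInitial⇒δ⊕δ (∈-avoiders⁻ π∈av) (s≤s z≤n) (s≤s j<n) pre))
          (∈-applyUpTo⁺ (δ⊕δ (suc n) ∘ suc) j<n)
  from : ∀ {π} → π ∈ decomposables (suc n) → π ∈ decomposableAvoiders (suc n)
  from π∈ with ∈-applyUpTo⁻ (δ⊕δ (suc n) ∘ suc) π∈
  ... | j , j<n , refl = ∈-filter⁺ (T? ∘ not ∘ indecomposableL (suc n)) (∈-avoiders⁺ (δ⊕δ-avoider (s≤s (<⇒≤ j<n))))
    (Equivalence.from T-not-≡ (cong not
      (any-true⁺ (prefixInitialL _) (∈-applyUpTo⁺ suc j<n) (prefixInitialL-δ⊕δ (suc n) (suc j)))))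

decomposables-unique : ∀ n → Unique (decomposables n)
decomposables-unique zero    = [] ∷ []
decomposables-unique (suc n) = applyUpTo⁺₁ (δ⊕δ (suc n) ∘ suc) n λ i<j _ eq → <⇒≢ i<j (∷-injectiveˡ eq)

sumMap-decomposableAvoiders : ∀ n (h : List ℕ → ℕ) →
                              sumMap h (decomposableAvoiders n) ≡ sumMap h (decomposables n)
sumMap-decomposableAvoiders n h = sumMap-unique-⇔ h (filter⁺ (T? ∘ not ∘ indecomposableL n) (avoiders-unique n))
  (decomposables-unique n) (decomposableAvoiders⇔decomposables {n})

desL-descending-++ : ∀ lo l ys → desL (descending lo (suc l) ++ ys) ≡ l + desL (lo + 0 ∷ ys)
desL-descending-++ lo zero    ys = refl
desL-descending-++ lo (suc l) ys rewrite <ᵇ-true (+-monoʳ-< lo (n<1+n l)) =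
  cong suc (desL-descending-++ lo l ys)

desL-δ⊕δ : ∀ m j → j ≤ m → desL (δ⊕δ (suc (suc m)) (suc j)) ≡ m
desL-δ⊕δ m j j≤m rewrite +-∸-assoc 1 j≤m = begin
  desL (descending 0 (suc j) ++ down)  ≡⟨ desL-descending-++ 0 j down ⟩
  j + desL down                        ≡⟨ cong (λ xs → j + desL xs) (++-identityʳ down) ⟨
  j + desL (down ++ [])                ≡⟨ cong (j +_) (desL-descending-++ (suc j) k []) ⟩
  j + (k + 0)                          ≡⟨ cong (j +_) (+-identityʳ k) ⟩
  j + k                                ≡⟨ m+[n∸m]≡n j≤m ⟩
  m                                    ∎
  where
  open ≡-Reasoning
  k = m ∸ j
  down = descending (suc j) (suc k)

sumMap-descents-decomposables : ∀ n i →
  sumMap (λ π → 𝟙 (desL π ≡ᵇ i)) (decomposables n) ≡ coeffX2over1mXQsq n i + coeffOne2 n i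
sumMap-descents-decomposables zero          zero    = refl
sumMap-descents-decomposables zero          (suc i) = refl
sumMap-descents-decomposables (suc zero)    i       = refl
sumMap-descents-decomposables (suc (suc m)) i       = begin
  sumMap (λ π → 𝟙 (desL π ≡ᵇ i)) Ds  ≡⟨ sumMap-cong-∈ Ds allHaveM ⟩
  sumMap (λ _ → 𝟙 (m ≡ᵇ i)) Ds       ≡⟨ sumMap-const (𝟙 (m ≡ᵇ i)) Ds ⟩
  length Ds * 𝟙 (m ≡ᵇ i)             ≡⟨ cong (_* 𝟙 (m ≡ᵇ i)) (length-applyUpTo (δ⊕δ (suc (suc m)) ∘ suc) (suc m)) ⟩
  suc m * 𝟙 (m ≡ᵇ i)                 ≡⟨ coefficient (m ≟ i) ⟩
  (if i ≡ᵇ m then suc m else 0) + 0  ∎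
  where
  open ≡-Reasoning
  Ds = decomposables (suc (suc m))
  allHaveM : ∀ {π} → π ∈ decomposables (suc (suc m)) → 𝟙 (desL π ≡ᵇ i) ≡ 𝟙 (m ≡ᵇ i)
  allHaveM π∈ with ∈-applyUpTo⁻ (δ⊕δ (suc (suc m)) ∘ suc) π∈
  ... | j , j<1+m , refl = cong (λ d → 𝟙 (d ≡ᵇ i)) (desL-δ⊕δ m j (s≤s⁻¹ j<1+m))
  coefficient : Dec (m ≡ i) → suc m * 𝟙 (m ≡ᵇ i) ≡ (if i ≡ᵇ m then suc m else 0) + 0
  coefficient (yes refl) rewrite ≡ᵇ-refl m = trans (*-identityʳ (suc m)) (sym (+-identityʳ (suc m)))
  coefficient (no m≢i) rewrite ≡ᵇ-false m≢i | ≡ᵇ-false (m≢i ∘ sym) = *-zeroʳ m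

length-decomposables : ∀ n → length (decomposables n) ≡ coeffX2over1mXsq n + coeffOne n
length-decomposables zero          = refl
length-decomposables (suc zero)    = refl
length-decomposables (suc (suc m)) =
  trans (length-applyUpTo (δ⊕δ (suc (suc m)) ∘ suc) (suc m)) (sym (+-identityʳ (suc m)))

desL≤length : ∀ xs → desL xs ≤ length xs
desL≤length []           = z≤n
desL≤length (x ∷ [])     = z≤n
desL≤length (x ∷ y ∷ xs) = step (y <ᵇ x) (desL≤length (y ∷ xs))
  where
  step : ∀ b {r l} → r ≤ l → (if b then 1 else 0) + r ≤ suc l
  step true  r≤l = s≤s r≤l
  step false r≤l = m≤n⇒m≤1+n r≤l

count-avoiders : ∀ n (Q : Vec (Fin n) n → Bool) (q : List ℕ → Bool) → (∀ v → Q v ≡ q (vals v)) →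
                 count (λ v → isPerm v ∧ avoids123 v ∧ Q v) ≡ sumMap (𝟙 ∘ q) (avoiders n)
count-avoiders n Q q Q≡q =
  trans (count≡sumMap-words n _ (λ w → isAvoider w ∧ q w) transfer) (sumMap-𝟙-∧ isAvoider q (words n n))
  where
  transfer : ∀ v → isPerm v ∧ avoids123 v ∧ Q v ≡ isAvoider (vals v) ∧ q (vals v)
  transfer v = trans (cong₂ _∧_ (isPerm≡ v) (cong₂ _∧_ (avoids123≡ v) (Q≡q v)))
                     (sym (∧-assoc (not (hasDuplicate (vals v))) (not (has123 (vals v))) (q (vals v))))

A123≡ : ∀ n i → A123 n i ≡ sumMap (λ π → 𝟙 (desL π ≡ᵇ i)) (avoiders n)
A123≡ n i = count-avoiders n _ _ (λ v → refl)

I123≡ : ∀ n i → I123 n i ≡ sumMap (λ π → 𝟙 (indecomposableL n π ∧ (desL π ≡ᵇ i))) (avoiders n)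
I123≡ n i = count-avoiders n _ _ (λ v → cong (_∧ (des v ≡ᵇ i)) (indecomposable≡ v))

avoiders-split : ∀ n (q : List ℕ → Bool) → sumMap (𝟙 ∘ q) (avoiders n) ≡
  sumMap (λ π → 𝟙 (indecomposableL n π ∧ q π)) (avoiders n) + sumMap (𝟙 ∘ q) (decomposables n)
avoiders-split n q = begin
  sumMap (𝟙 ∘ q) (avoiders n)
    ≡⟨ sumMap-cong-∈ (avoiders n) (λ {π} _ → 𝟙-split (p π) (q π)) ⟩
  sumMap (λ π → 𝟙 (p π ∧ q π) + 𝟙 (not (p π) ∧ q π)) (avoiders n)
    ≡⟨ sumMap-+ (λ π → 𝟙 (p π ∧ q π)) (λ π → 𝟙 (not (p π) ∧ q π)) (avoiders n) ⟩
  sumMap (λ π → 𝟙 (p π ∧ q π)) (avoiders n) + sumMap (λ π → 𝟙 (not (p π) ∧ q π)) (avoiders n)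
    ≡⟨ cong (sumMap (λ π → 𝟙 (p π ∧ q π)) (avoiders n) +_)
         (trans (sumMap-𝟙-∧ (not ∘ p) q (avoiders n)) (sumMap-decomposableAvoiders n (𝟙 ∘ q))) ⟩
  sumMap (λ π → 𝟙 (p π ∧ q π)) (avoiders n) + sumMap (𝟙 ∘ q) (decomposables n) ∎
  where
  open ≡-Reasoning
  p = indecomposableL n

descents-split : ∀ n i → A123 n i ≡ I123 n i + coeffX2over1mXQsq n i + coeffOne2 n i
descents-split n i = begin
  A123 n i                                                    ≡⟨ A123≡ n i ⟩
  sumMap (λ π → 𝟙 (desL π ≡ᵇ i)) (avoiders n)                 ≡⟨ avoiders-split n (λ π → desL π ≡ᵇ i) ⟩
  sumMap (λ π → 𝟙 (indecomposableL n π ∧ (desL π ≡ᵇ i))) (avoiders n)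
    + sumMap (λ π → 𝟙 (desL π ≡ᵇ i)) (decomposables n)
    ≡⟨ cong₂ _+_ (sym (I123≡ n i)) (sumMap-descents-decomposables n i) ⟩
  I123 n i + (coeffX2over1mXQsq n i + coeffOne2 n i)          ≡⟨ +-assoc (I123 n i) _ _ ⟨
  I123 n i + coeffX2over1mXQsq n i + coeffOne2 n i            ∎
  where open ≡-Reasoning

I123n≡ : ∀ n → I123n n ≡ sumMap (𝟙 ∘ indecomposableL n) (avoiders n)
I123n≡ n = begin
  sumMap (I123 n) (upTo (suc n))
    ≡⟨ sumMap-cong-∈ (upTo (suc n)) (λ {i} _ → I123≡ n i) ⟩
  sumMap (λ i → sumMap (λ π → 𝟙 (indecomposableL n π ∧ (desL π ≡ᵇ i))) (avoiders n)) (upTo (suc n))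
    ≡⟨ sumMap-comm (λ i π → 𝟙 (indecomposableL n π ∧ (desL π ≡ᵇ i))) (upTo (suc n)) (avoiders n) ⟩
  sumMap (λ π → sumMap (λ i → 𝟙 (indecomposableL n π ∧ (desL π ≡ᵇ i))) (upTo (suc n))) (avoiders n)
    ≡⟨ sumMap-cong-∈ (avoiders n) (λ {π} π∈ → sumMap-𝟙-∧-≡ᵇ (indecomposableL n π) (suc n) (s≤s (desL≤n π∈))) ⟩
  sumMap (𝟙 ∘ indecomposableL n) (avoiders n) ∎
  where
  open ≡-Reasoning
  desL≤n : ∀ {π} → π ∈ avoiders n → desL π ≤ n
  desL≤n {π} π∈ = subst (desL π ≤_) (Avoider.length≡ (∈-avoiders⁻ π∈)) (desL≤length π)

catalan-split : ∀ n → I123n n + (coeffX2over1mXsq n + coeffOne n) ≡ catalan n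
catalan-split n = begin
  I123n n + (coeffX2over1mXsq n + coeffOne n)
    ≡⟨ cong₂ _+_ (I123n≡ n) (sym (length-decomposables n)) ⟩
  sumMap (𝟙 ∘ indecomposableL n) (avoiders n) + length (decomposables n)
    ≡⟨ cong₂ _+_ (sumMap-cong-∈ (avoiders n) (λ {π} _ → cong 𝟙 (∧-identityʳ (indecomposableL n π))))
                 (sumMap-1 (decomposables n)) ⟨
  sumMap (λ π → 𝟙 (indecomposableL n π ∧ true)) (avoiders n) + sumMap (λ _ → 1) (decomposables n)
    ≡⟨ avoiders-split n (λ _ → true) ⟨
  sumMap (λ _ → 1) (avoiders n)   ≡⟨ sumMap-1 (avoiders n) ⟩
  length (avoiders n)             ≡⟨ length-avoiders n ⟩
  ballot n 0                      ≡⟨ ballot-catalan n ⟩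
  catalan n ∎
  where
  open ≡-Reasoning
  sumMap-1 : ∀ (xs : List (List ℕ)) → sumMap (λ _ → 1) xs ≡ length xs
  sumMap-1 xs = trans (sumMap-const 1 xs) (*-identityʳ (length xs))

open import Data.Integer using (+_; _-_)
open import Data.Integer.Properties using ([+m]-[+n]≡m⊖n; ⊖-≥)

+[m+n]-+n≡+m : ∀ m n → + (m + n) - + n ≡ + m
+[m+n]-+n≡+m m n = trans ([+m]-[+n]≡m⊖n (m + n) n) (trans (⊖-≥ (m≤n+m n m)) (cong +_ (m+n∸n≡m m n)))

I123n-formula : ∀ n → + I123n n ≡ + coeffCatalanGF n - + coeffX2over1mXsq n - + coeffOne n
I123n-formula n = sym (begin
  + catalan n - + X - + O          ≡⟨ cong (λ c → + c - + X - + O) reordered ⟨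
  + (I123n n + O + X) - + X - + O  ≡⟨ cong (_- + O) (+[m+n]-+n≡+m (I123n n + O) X) ⟩
  + (I123n n + O) - + O            ≡⟨ +[m+n]-+n≡+m (I123n n) O ⟩
  + I123n n                        ∎)
  where
  open ≡-Reasoning
  X = coeffX2over1mXsq n
  O = coeffOne n
  reordered : I123n n + O + X ≡ catalan n
  reordered = trans (+-assoc (I123n n) O X) (trans (cong (_+_ (I123n n)) (+-comm O X)) (catalan-split n))

I123n-catalan : ∀ n → n ≥ 1 → + I123n n ≡ + catalan n - + (n ∸ 1)
I123n-catalan (suc m) _ = sym (trans (cong (λ c → + c - + m) (sym split)) (+[m+n]-+n≡+m (I123n (suc m)) m))
  where
  corrections : ∀ m → coeffX2over1mXsq (suc m) + coeffOne (suc m) ≡ m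
  corrections zero    = refl
  corrections (suc m) = +-identityʳ (suc m)
  split : I123n (suc m) + m ≡ catalan (suc m)
  split = trans (cong (_+_ (I123n (suc m))) (sym (corrections m))) (catalan-split (suc m))

theorem3p5 : (∀ (n i : ℕ) → A123 n i ≡ I123 n i + coeffX2over1mXQsq n i + coeffOne2 n i)
    × (∀ (n : ℕ) → + I123n n ≡ + coeffCatalanGF n - + coeffX2over1mXsq n - + coeffOne n)
    × (∀ (n : ℕ) → n ≥ 1 → + I123n n ≡ + catalan n - + (n ∸ 1))
theorem3p5 = descents-split , I123n-formula , I123n-catalan
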